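{- Let $\mathbb{K}$ be a finite field with $q$ elements, $\mathbb{F}$ an extension of $\mathbb{K}$ with $[\mathbb{F}:\mathbb{K}]=n$, $U$ an $m$-dimensional $\mathbb{K}$-subspace of $\mathbb{F}$, and $s$ an integer with $\gcd(n,s)=1$. Then the set \[ \{a_0X+a_1X^{q^s}+\dots+a_{m-1}X^{q^{s(m-1)}}: a_0,\dots,a_{m-1}\in\mathbb{F}\} \] is a complete system of distinct representatives for $\mathrm{L}_{\mathbb{F}/\mathbb{K}}/(\theta_U)$.
   Context: $\mathrm{L}_{\mathbb{F}/\mathbb{K}}=\{\sum_i c_iX^{q^i}: c_i\in\mathbb{F}\}$ is the set of $\mathbb{K}$-linearized polynomials over $\mathbb{F}$. $\theta_U=\prod_{u\in U}(X-u)$ and $(\theta_U)$ is the set of elements of $\mathrm{L}_{\mathbb{F}/\mathbb{K}}$ divisible by $\theta_U$ in $\mathbb{F}[X]$; the quotient is as $\mathbb{K}$-vector spaces. -}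

module Defs where

open import Level using (0ℓ)
open import Algebra.Bundles using (CommutativeRing)
open import Algebra.Morphism.Structures using (module RingMorphisms)
open import Data.Nat using (ℕ; zero; suc)
import Data.Nat as ℕ
open import Data.Fin using (Fin)
import Data.Fin as Fin
open import Data.List using (List; []; _∷_; map; foldr; replicate; _++_; concatMap; allFin)
open import Data.Product using (Σ; ∃; _,_)
open import Relation.Nullary using (¬_)
open import Relation.Binary.PropositionalEquality using (_≡_)

IsField : CommutativeRing 0ℓ 0ℓ → Set
IsField R = (¬ (1# ≈ 0#)) Data.Product.× (∀ x → ¬ (x ≈ 0#) → ∃ λ y → (x * y) ≈ 1#)
  where open CommutativeRing R

IsRingHom : (K F : CommutativeRing 0ℓ 0ℓ) → (CommutativeRing.Carrier K → CommutativeRing.Carrier F) → Set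
IsRingHom K F ι = RingMorphisms.IsRingHomomorphism (CommutativeRing.rawRing K) (CommutativeRing.rawRing F) ι

HasCard : (K : CommutativeRing 0ℓ 0ℓ) → (q : ℕ) → (Fin q → CommutativeRing.Carrier K) → Set
HasCard K q e = (∀ i j → e i ≈ e j → i ≡ j) Data.Product.× (∀ x → ∃ λ i → x ≈ e i)
  where open CommutativeRing K

module _ (F : CommutativeRing 0ℓ 0ℓ) where
  open CommutativeRing F

  sumF : ∀ {k} → (Fin k → Carrier) → Carrier
  sumF {zero} f = 0#
  sumF {suc k} f = f Fin.zero + sumF (λ j → f (Fin.suc j))

  -- Polynomials over F as coefficient lists (constant term first).
  Poly : Set
  Poly = List Carrier

  coeff : Poly → ℕ → Carrier
  coeff [] i = 0#
  coeff (a ∷ p) zero = a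
  coeff (a ∷ p) (suc i) = coeff p i

  -- equality of polynomials: all coefficients equal (trailing zeros irrelevant)
  _≈P_ : Poly → Poly → Set
  p ≈P r = ∀ i → coeff p i ≈ coeff r i

  _+P_ : Poly → Poly → Poly
  [] +P r = r
  (a ∷ p) +P [] = a ∷ p
  (a ∷ p) +P (b ∷ r) = (a + b) ∷ (p +P r)

  -P_ : Poly → Poly
  -P p = map -_ p

  _-P_ : Poly → Poly → Poly
  p -P r = p +P (-P r)

  _*P_ : Poly → Poly → Poly
  [] *P r = []
  (a ∷ p) *P r = map (a *_) r +P (0# ∷ (p *P r))

  oneP : Poly
  oneP = 1# ∷ []

  prodP : List Poly → Poly
  prodP = foldr _*P_ oneP

  _∣P_ : Poly → Poly → Set
  d ∣P p = Σ Poly λ g → p ≈P (d *P g)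

  monomial : Carrier → ℕ → Poly
  monomial c k = replicate k 0# ++ (c ∷ [])

  sumP : ∀ {k} → (Fin k → Poly) → Poly
  sumP {zero} f = []
  sumP {suc k} f = f Fin.zero +P sumP (λ j → f (Fin.suc j))

  X-minus : Carrier → Poly
  X-minus u = (- u) ∷ 1# ∷ []

  linearizedFrom : ℕ → ℕ → List Carrier → Poly
  linearizedFrom q i [] = []
  linearizedFrom q i (c ∷ cs) = monomial c (q ℕ.^ i) +P linearizedFrom q (suc i) cs

  linearized : ℕ → List Carrier → Poly
  linearized q cs = linearizedFrom q 0 cs

  -- membership in L_{F/K}  (q = |K|)
  IsLinearized : ℕ → Poly → Set
  IsLinearized q p = Σ (List Carrier) λ cs → p ≈P linearized q cs

  sPoly : (q s : ℕ) {m : ℕ} → (Fin m → Carrier) → Poly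
  sPoly q s {m} a = sumP (λ (j : Fin m) → monomial (a j) (q ℕ.^ (s ℕ.* Fin.toℕ j)))

-- all functions Fin m → Fin q, each listed exactly once
allVecs : (q m : ℕ) → List (Fin m → Fin q)
allVecs q zero = (λ ()) ∷ []
allVecs q (suc m) = concatMap (λ v → map (λ k → cons k v) (allFin q)) (allVecs q m)
  where
  cons : ∀ {m} → Fin q → (Fin m → Fin q) → Fin (suc m) → Fin q
  cons k v Fin.zero = k
  cons k v (Fin.suc j) = v j

module _ (K F : CommutativeRing 0ℓ 0ℓ) (ι : CommutativeRing.Carrier K → CommutativeRing.Carrier F) where
  private
    module K = CommutativeRing K
  open CommutativeRing F

  linComb : ∀ {k} → (Fin k → K.Carrier) → (Fin k → Carrier) → Carrier
  linComb c b = sumF F (λ j → ι (c j) * b j)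

  LinIndep : ∀ {k} → (Fin k → Carrier) → Set
  LinIndep b = ∀ c → linComb c b ≈ 0# → ∀ j → c j K.≈ K.0#

  Spans : ∀ {k} → (Fin k → Carrier) → Set
  Spans b = ∀ x → ∃ λ c → x ≈ linComb c b

  IsBasis : ∀ {k} → (Fin k → Carrier) → Set
  IsBasis b = LinIndep b Data.Product.× Spans b

  -- θ_U = Π_{u ∈ U} (X - u), where U is the K-span of u₁..u_m and K = {e 0, ..., e (q-1)}
  θ : (q : ℕ) (e : Fin q → K.Carrier) {m : ℕ} → (Fin m → Carrier) → Poly F
  θ q e {m} ub = prodP F (map (λ v → X-minus F (linComb (λ j → e (v j)) ub)) (allVecs q m))

module Submission where

-- Let σ(x) = x^(q^s). As gcd(n, s) = 1, the fixed field of σ is K. Evaluating sPoly a gives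
-- the K-linear map Lₐ = Σ aⱼ σʲ, and a polynomial whose evaluation is K-linear is divisible by
-- θ_U exactly when it vanishes on the basis u of U. A Moore-determinant argument (induction by
-- Abel summation, using that σ fixes only K) shows that Lₐ vanishes on m independent vectors only
-- for a = 0, so a ↦ (Lₐ(uⱼ))ⱼ is an injective, hence, F being finite, bijective map Fᵐ → Fᵐ.
-- Surjectivity yields for every linearized L an a with L - sPoly a vanishing on u, and
-- injectivity makes it unique.

open import Defs
open import Level using (0ℓ)
open import Algebra.Bundles using (CommutativeRing)
open import Algebra.Morphism.Structures using (module RingMorphisms)
import Algebra.Properties.Ring
import Algebra.Properties.Semiring.Exp
import Algebra.Properties.Semiring.Mult
open import Data.Empty using (⊥-elim)
open import Data.Fin as Fin using (Fin)
import Data.Fin.Properties as Fin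
open import Data.Fin.Permutation using (Permutation; permutation)
open import Data.List using (List; []; _∷_; map; length; tabulate; replicate; allFin)
import Data.List.Properties as List
open import Data.List.Membership.Propositional.Properties using (∈-allFin)
open import Data.List.Relation.Unary.All as All using (All; []; _∷_)
import Data.List.Relation.Unary.All.Properties as All
open import Data.List.Relation.Unary.AllPairs using (AllPairs; []; _∷_)
import Data.List.Relation.Unary.AllPairs as AllPairs
import Data.List.Relation.Unary.AllPairs.Properties as AllPairs
open import Data.List.Relation.Unary.Any using (Any; here; there)
import Data.List.Relation.Unary.Any as Any
import Data.List.Relation.Unary.Any.Properties as Any
open import Data.List.Relation.Unary.Unique.Propositional.Properties using (allFin⁺)
open import Data.Nat as ℕ using (ℕ; zero; suc; _∸_)
import Data.Nat.Properties as ℕ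
open import Data.Nat.Combinatorics using (_C_; nCn≡1)
open import Data.Nat.GCD using (gcd; gcd-GCD; module Bézout)
open import Data.Product as Product using (∃; _,_; proj₁; proj₂)
open import Function using (_∘_)
open import Relation.Binary.Bundles using (Setoid)
open import Relation.Binary.Core using (Rel)
open import Relation.Binary.Definitions using (Decidable)
open import Relation.Binary.PropositionalEquality as ≡ using (_≡_)
open import Relation.Nullary using (¬_; yes; no)

module Polynomials (R : CommutativeRing 0ℓ 0ℓ) where
  open CommutativeRing R hiding (zero)
  open import Relation.Binary.Reasoning.Setoid setoid
  open import Algebra.Properties.Ring ring using (-‿distribʳ-*; -0#≈0#; -‿+-comm)
  open import Algebra.Solver.Ring.NaturalCoefficients.Default commutativeSemiring
    using (solve; _:=_; _:+_; _:*_)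
  open import Algebra.Properties.Semiring.Exp semiring using (_^_)

  infixl 6 _+ₚ_ _-ₚ_
  infixl 7 _*ₚ_ _·_
  infix 4 _≋_

  _+ₚ_ _-ₚ_ _*ₚ_ : Poly R → Poly R → Poly R
  _+ₚ_ = _+P_ R
  _-ₚ_ = _-P_ R
  _*ₚ_ = _*P_ R

  _·_ : Carrier → Poly R → Poly R
  c · p = map (c *_) p

  -- Coefficientwise equality as a record, so that both polynomials can be inferred from a proof.
  record _≋_ (p r : Poly R) : Set where
    constructor mk≋
    field coeff-≈ : ∀ i → coeff R p i ≈ coeff R r i
  open _≋_ public

  ≋-refl : ∀ {p} → p ≋ p
  coeff-≈ ≋-refl i = refl

  ≋-sym : ∀ {p r} → p ≋ r → r ≋ p
  coeff-≈ (≋-sym e) i = sym (coeff-≈ e i)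

  ≋-trans : ∀ {p r t} → p ≋ r → r ≋ t → p ≋ t
  coeff-≈ (≋-trans e f) i = trans (coeff-≈ e i) (coeff-≈ f i)

  ∷-cong : ∀ {a b p r} → a ≈ b → p ≋ r → a ∷ p ≋ b ∷ r
  coeff-≈ (∷-cong e f) zero = e
  coeff-≈ (∷-cong e f) (suc i) = coeff-≈ f i

  ∷-tail : ∀ {a b p r} → a ∷ p ≋ b ∷ r → p ≋ r
  coeff-≈ (∷-tail e) i = coeff-≈ e (suc i)

  IsZero : Poly R → Set
  IsZero p = ∀ i → coeff R p i ≈ 0#

  coeff-+ₚ : ∀ p r i → coeff R (p +ₚ r) i ≈ coeff R p i + coeff R r i
  coeff-+ₚ [] r i = sym (+-identityˡ _)
  coeff-+ₚ (a ∷ p) [] i = sym (+-identityʳ _)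
  coeff-+ₚ (a ∷ p) (b ∷ r) zero = refl
  coeff-+ₚ (a ∷ p) (b ∷ r) (suc i) = coeff-+ₚ p r i

  coeff-· : ∀ c p i → coeff R (c · p) i ≈ c * coeff R p i
  coeff-· c [] i = sym (zeroʳ c)
  coeff-· c (a ∷ p) zero = refl
  coeff-· c (a ∷ p) (suc i) = coeff-· c p i

  coeff-negₚ : ∀ p i → coeff R (-P_ R p) i ≈ - coeff R p i
  coeff-negₚ [] i = sym -0#≈0#
  coeff-negₚ (a ∷ p) zero = refl
  coeff-negₚ (a ∷ p) (suc i) = coeff-negₚ p i

  coeff--ₚ : ∀ p r i → coeff R (p -ₚ r) i ≈ coeff R p i - coeff R r i
  coeff--ₚ p r i = trans (coeff-+ₚ p (-P_ R r) i) (+-congˡ (coeff-negₚ r i))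

  coeff-∷*ₚ : ∀ a p h i → coeff R ((a ∷ p) *ₚ h) i ≈ a * coeff R h i + coeff R (0# ∷ p *ₚ h) i
  coeff-∷*ₚ a p h i = trans (coeff-+ₚ (a · h) (0# ∷ p *ₚ h) i) (+-congʳ (coeff-· a h i))

  +ₚ-cong : ∀ {p p′ r r′} → p ≋ p′ → r ≋ r′ → p +ₚ r ≋ p′ +ₚ r′
  coeff-≈ (+ₚ-cong {p} {p′} {r} {r′} e f) i =
    trans (coeff-+ₚ p r i) (trans (+-cong (coeff-≈ e i) (coeff-≈ f i)) (sym (coeff-+ₚ p′ r′ i)))

  ·-cong : ∀ {c c′ p p′} → c ≈ c′ → p ≋ p′ → c · p ≋ c′ · p′
  coeff-≈ (·-cong {c} {c′} {p} {p′} e f) i =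
    trans (coeff-· c p i) (trans (*-cong e (coeff-≈ f i)) (sym (coeff-· c′ p′ i)))

  *ₚ-congˡ : ∀ p {h h′} → h ≋ h′ → p *ₚ h ≋ p *ₚ h′
  *ₚ-congˡ [] e = ≋-refl
  *ₚ-congˡ (a ∷ p) e = +ₚ-cong (·-cong refl e) (∷-cong refl (*ₚ-congˡ p e))

  *ₚ-distribʳ : ∀ p r h → (p +ₚ r) *ₚ h ≋ p *ₚ h +ₚ r *ₚ h
  *ₚ-distribʳ [] r h = ≋-refl
  coeff-≈ (*ₚ-distribʳ (a ∷ p) [] h) i = sym (trans (coeff-+ₚ ((a ∷ p) *ₚ h) [] i) (+-identityʳ _))
  coeff-≈ (*ₚ-distribʳ (a ∷ p) (b ∷ r) h) i = begin
    coeff R (((a + b) ∷ p +ₚ r) *ₚ h) i                      ≈⟨ coeff-∷*ₚ (a + b) (p +ₚ r) h i ⟩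
    (a + b) * x + coeff R (0# ∷ (p +ₚ r) *ₚ h) i             ≈⟨ +-congˡ (tails i) ⟩
    (a + b) * x + (y i + z i)                                ≈⟨ solve 5 (λ a b x y z → (a :+ b) :* x :+ (y :+ z) := (a :* x :+ y) :+ (b :* x :+ z)) refl a b x (y i) (z i) ⟩
    (a * x + y i) + (b * x + z i)                            ≈⟨ +-cong (coeff-∷*ₚ a p h i) (coeff-∷*ₚ b r h i) ⟨
    coeff R ((a ∷ p) *ₚ h) i + coeff R ((b ∷ r) *ₚ h) i      ≈⟨ coeff-+ₚ ((a ∷ p) *ₚ h) ((b ∷ r) *ₚ h) i ⟨
    coeff R ((a ∷ p) *ₚ h +ₚ (b ∷ r) *ₚ h) i                 ∎
    where
    x = coeff R h i
    y z : ℕ → Carrier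
    y = coeff R (0# ∷ p *ₚ h)
    z = coeff R (0# ∷ r *ₚ h)
    tails : ∀ i → coeff R (0# ∷ (p +ₚ r) *ₚ h) i ≈ y i + z i
    tails zero = sym (+-identityʳ 0#)
    tails (suc i) = trans (coeff-≈ (*ₚ-distribʳ p r h) i) (coeff-+ₚ (p *ₚ h) (r *ₚ h) i)

  ·-*ₚ : ∀ c p h → (c · p) *ₚ h ≋ c · (p *ₚ h)
  ·-*ₚ c [] h = ≋-refl
  coeff-≈ (·-*ₚ c (a ∷ p) h) i = begin
    coeff R ((c * a ∷ c · p) *ₚ h) i                     ≈⟨ coeff-∷*ₚ (c * a) (c · p) h i ⟩
    c * a * coeff R h i + coeff R (0# ∷ (c · p) *ₚ h) i  ≈⟨ +-congˡ (tails i) ⟩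
    c * a * coeff R h i + c * coeff R (0# ∷ p *ₚ h) i    ≈⟨ solve 4 (λ c a x y → c :* a :* x :+ c :* y := c :* (a :* x :+ y)) refl c a (coeff R h i) _ ⟩
    c * (a * coeff R h i + coeff R (0# ∷ p *ₚ h) i)      ≈⟨ *-congˡ (coeff-∷*ₚ a p h i) ⟨
    c * coeff R ((a ∷ p) *ₚ h) i                         ≈⟨ coeff-· c ((a ∷ p) *ₚ h) i ⟨
    coeff R (c · ((a ∷ p) *ₚ h)) i                       ∎
    where
    tails : ∀ i → coeff R (0# ∷ (c · p) *ₚ h) i ≈ c * coeff R (0# ∷ p *ₚ h) i
    tails zero = sym (zeroʳ c)
    tails (suc i) = trans (coeff-≈ (·-*ₚ c p h) i) (coeff-· c (p *ₚ h) i)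

  0∷-*ₚ : ∀ t h → (0# ∷ t) *ₚ h ≋ 0# ∷ t *ₚ h
  coeff-≈ (0∷-*ₚ t h) i = trans (coeff-∷*ₚ 0# t h i) (trans (+-congʳ (zeroˡ _)) (+-identityˡ _))

  *ₚ-assoc : ∀ p r h → (p *ₚ r) *ₚ h ≋ p *ₚ (r *ₚ h)
  *ₚ-assoc [] r h = ≋-refl
  *ₚ-assoc (a ∷ p) r h =
    ≋-trans (*ₚ-distribʳ (a · r) (0# ∷ p *ₚ r) h)
      (+ₚ-cong (·-*ₚ a r h) (≋-trans (0∷-*ₚ (p *ₚ r) h) (∷-cong refl (*ₚ-assoc p r h))))

  oneP-*ₚ : ∀ p → oneP R *ₚ p ≋ p
  coeff-≈ (oneP-*ₚ p) i = trans (coeff-∷*ₚ 1# [] p i) (trans (+-cong (*-identityˡ _) (zeros i)) (+-identityʳ _))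
    where
    zeros : ∀ i → coeff R (0# ∷ []) i ≈ 0#
    zeros zero = refl
    zeros (suc i) = refl

  eval : Poly R → Carrier → Carrier
  eval [] x = 0#
  eval (a ∷ p) x = a + x * eval p x

  eval-IsZero : ∀ p x → IsZero p → eval p x ≈ 0#
  eval-IsZero [] x z = refl
  eval-IsZero (a ∷ p) x z =
    trans (+-cong (z 0) (trans (*-congˡ (eval-IsZero p x (z ∘ suc))) (zeroʳ x))) (+-identityʳ _)

  eval-≋ : ∀ {p r} x → p ≋ r → eval p x ≈ eval r x
  eval-≋ {[]} {r} x e = sym (eval-IsZero r x (λ i → sym (coeff-≈ e i)))
  eval-≋ {a ∷ p} {[]} x e = eval-IsZero (a ∷ p) x (coeff-≈ e)
  eval-≋ {a ∷ p} {b ∷ r} x e = +-cong (coeff-≈ e 0) (*-congˡ (eval-≋ x (∷-tail e)))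

  eval-+ₚ : ∀ p r x → eval (p +ₚ r) x ≈ eval p x + eval r x
  eval-+ₚ [] r x = sym (+-identityˡ _)
  eval-+ₚ (a ∷ p) [] x = sym (+-identityʳ _)
  eval-+ₚ (a ∷ p) (b ∷ r) x = begin
    (a + b) + x * eval (p +ₚ r) x          ≈⟨ +-congˡ (*-congˡ (eval-+ₚ p r x)) ⟩
    (a + b) + x * (eval p x + eval r x)    ≈⟨ solve 5 (λ a b x u v → (a :+ b) :+ x :* (u :+ v) := (a :+ x :* u) :+ (b :+ x :* v)) refl a b x (eval p x) (eval r x) ⟩
    (a + x * eval p x) + (b + x * eval r x) ∎

  eval-· : ∀ c p x → eval (c · p) x ≈ c * eval p x
  eval-· c [] x = sym (zeroʳ c)
  eval-· c (a ∷ p) x = trans (+-congˡ (*-congˡ (eval-· c p x)))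
    (solve 4 (λ c a x u → c :* a :+ x :* (c :* u) := c :* (a :+ x :* u)) refl c a x (eval p x))

  eval-negₚ : ∀ p x → eval (-P_ R p) x ≈ - eval p x
  eval-negₚ [] x = sym -0#≈0#
  eval-negₚ (a ∷ p) x =
    trans (+-congˡ (trans (*-congˡ (eval-negₚ p x)) (sym (-‿distribʳ-* x (eval p x))))) (-‿+-comm a (x * eval p x))

  eval--ₚ : ∀ p r x → eval (p -ₚ r) x ≈ eval p x - eval r x
  eval--ₚ p r x = trans (eval-+ₚ p (-P_ R r) x) (+-congˡ (eval-negₚ r x))

  eval-*ₚ : ∀ p h x → eval (p *ₚ h) x ≈ eval p x * eval h x
  eval-*ₚ [] h x = sym (zeroˡ _)
  eval-*ₚ (a ∷ p) h x = begin
    eval (a · h +ₚ (0# ∷ p *ₚ h)) x           ≈⟨ eval-+ₚ (a · h) (0# ∷ p *ₚ h) x ⟩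
    eval (a · h) x + (0# + x * eval (p *ₚ h) x) ≈⟨ +-cong (eval-· a h x) (trans (+-identityˡ _) (*-congˡ (eval-*ₚ p h x))) ⟩
    a * eval h x + x * (eval p x * eval h x)  ≈⟨ solve 4 (λ a x u v → a :* v :+ x :* (u :* v) := (a :+ x :* u) :* v) refl a x (eval p x) (eval h x) ⟩
    (a + x * eval p x) * eval h x             ∎

  eval-monomial : ∀ c k x → eval (monomial R c k) x ≈ x ^ k * c
  eval-monomial c zero x = trans (+-congˡ (zeroʳ x)) (trans (+-identityʳ c) (sym (*-identityˡ c)))
  eval-monomial c (suc k) x = trans (+-identityˡ _) (trans (*-congˡ (eval-monomial c k x)) (sym (*-assoc _ _ _)))

  eval-X-minus : ∀ u x → eval (X-minus R u) x ≈ x - u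
  eval-X-minus u x = trans (+-congˡ (trans (*-congˡ (trans (+-congˡ (zeroʳ x)) (+-identityʳ 1#))) (*-identityʳ x))) (+-comm _ _)

  eval-sumP : ∀ {k} (f : Fin k → Poly R) x → eval (sumP R f) x ≈ sumF R (λ j → eval (f j) x)
  eval-sumP {zero} f x = refl
  eval-sumP {suc k} f x = trans (eval-+ₚ (f Fin.zero) (sumP R (f ∘ Fin.suc)) x) (+-congˡ (eval-sumP (f ∘ Fin.suc) x))

  monomial-cong : ∀ {c c′} k → c ≈ c′ → monomial R c k ≋ monomial R c′ k
  monomial-cong zero c≈c′ = ∷-cong c≈c′ ≋-refl
  monomial-cong (suc k) c≈c′ = ∷-cong refl (monomial-cong k c≈c′)

  sumP-cong : ∀ {k} {f g : Fin k → Poly R} → (∀ j → f j ≋ g j) → sumP R f ≋ sumP R g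
  sumP-cong {zero} f≋g = ≋-refl
  sumP-cong {suc k} f≋g = +ₚ-cong (f≋g Fin.zero) (sumP-cong (f≋g ∘ Fin.suc))

  ∣P⇒root : ∀ d p x → _∣P_ R d p → eval d x ≈ 0# → eval p x ≈ 0#
  ∣P⇒root d p x (g , p≈dg) dx≈0 = begin
    eval p x            ≈⟨ eval-≋ x (mk≋ {p} {d *ₚ g} p≈dg) ⟩
    eval (d *ₚ g) x     ≈⟨ eval-*ₚ d g x ⟩
    eval d x * eval g x ≈⟨ *-congʳ dx≈0 ⟩
    0# * eval g x       ≈⟨ zeroˡ _ ⟩
    0#                  ∎

module FieldPolynomials (R : CommutativeRing 0ℓ 0ℓ) (isField : IsField R) where
  open CommutativeRing R hiding (zero)
  open Polynomials R
  open import Algebra.Properties.Semiring.Exp semiring using (_^_)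
  open import Relation.Binary.Reasoning.Setoid setoid
  open import Algebra.Properties.Ring ring using (x∙y⁻¹≈ε⇒x≈y; x≈y⇒x∙y⁻¹≈ε)

  1≉0 : ¬ 1# ≈ 0#
  1≉0 = proj₁ isField

  _⁻¹ : ∀ {x} → ¬ x ≈ 0# → Carrier
  x≉0 ⁻¹ = proj₁ (proj₂ isField _ x≉0)

  *-inverseʳ : ∀ {x} (x≉0 : ¬ x ≈ 0#) → x * x≉0 ⁻¹ ≈ 1#
  *-inverseʳ x≉0 = proj₂ (proj₂ isField _ x≉0)

  x*[y*x⁻¹]≈y : ∀ {x} (x≉0 : ¬ x ≈ 0#) y → x * (y * x≉0 ⁻¹) ≈ y
  x*[y*x⁻¹]≈y {x} x≉0 y = begin
    x * (y * x≉0 ⁻¹)   ≈⟨ x∙yz≈y∙xz x y _ ⟩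
    y * (x * x≉0 ⁻¹)   ≈⟨ *-congˡ (*-inverseʳ x≉0) ⟩
    y * 1#             ≈⟨ *-identityʳ y ⟩
    y                  ∎
    where open import Algebra.Properties.CommutativeSemigroup *-commutativeSemigroup using (x∙yz≈y∙xz)

  x*y≈0⇒y≈0 : ∀ {x y} → ¬ x ≈ 0# → x * y ≈ 0# → y ≈ 0#
  x*y≈0⇒y≈0 {x} {y} x≉0 xy≈0 = begin
    y                      ≈⟨ *-identityˡ y ⟨
    1# * y                 ≈⟨ *-congʳ (trans (*-comm _ _) (*-inverseʳ x≉0)) ⟨
    (x≉0 ⁻¹ * x) * y       ≈⟨ *-assoc _ _ _ ⟩
    x≉0 ⁻¹ * (x * y)       ≈⟨ *-congˡ xy≈0 ⟩
    x≉0 ⁻¹ * 0#            ≈⟨ zeroʳ _ ⟩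
    0#                     ∎

  *-≉0 : ∀ {x y} → ¬ x ≈ 0# → ¬ y ≈ 0# → ¬ x * y ≈ 0#
  *-≉0 x≉0 y≉0 xy≈0 = y≉0 (x*y≈0⇒y≈0 x≉0 xy≈0)

  x≉y⇒x-y≉0 : ∀ {x y} → ¬ x ≈ y → ¬ x - y ≈ 0#
  x≉y⇒x-y≉0 x≉y x-y≈0 = x≉y (x∙y⁻¹≈ε⇒x≈y _ _ x-y≈0)

  -- Synthetic division by X - a: the quotient, with remainder eval p a.
  quot : Carrier → Poly R → Poly R
  quot a [] = []
  quot a (c ∷ []) = []
  quot a (c ∷ b ∷ p) = eval (b ∷ p) a ∷ quot a (b ∷ p)

  length-quot : ∀ a p → length (quot a p) ≡ ℕ.pred (length p)
  length-quot a [] = ≡.refl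
  length-quot a (c ∷ []) = ≡.refl
  length-quot a (c ∷ b ∷ p) = ≡.cong suc (length-quot a (b ∷ p))

  coeff-divisionForm₀ : ∀ a g r → coeff R (X-minus R a *ₚ g +ₚ (r ∷ [])) 0 ≈ (- a) * coeff R g 0 + r
  coeff-divisionForm₀ a g r =
    trans (coeff-+ₚ (X-minus R a *ₚ g) (r ∷ []) 0) (+-congʳ (trans (coeff-∷*ₚ (- a) (1# ∷ []) g 0) (+-identityʳ _)))

  coeff-divisionFormₛ : ∀ a g r i → coeff R (X-minus R a *ₚ g +ₚ (r ∷ [])) (suc i) ≈ coeff R g i + (- a) * coeff R g (suc i)
  coeff-divisionFormₛ a g r i = begin
    coeff R (X-minus R a *ₚ g +ₚ (r ∷ [])) (suc i)                  ≈⟨ coeff-+ₚ (X-minus R a *ₚ g) (r ∷ []) (suc i) ⟩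
    coeff R (X-minus R a *ₚ g) (suc i) + coeff R (r ∷ []) (suc i)   ≈⟨ +-cong (coeff-∷*ₚ (- a) (1# ∷ []) g (suc i)) (no-tail i) ⟩
    ((- a) * coeff R g (suc i) + coeff R ((1# ∷ []) *ₚ g) i) + 0#   ≈⟨ +-identityʳ _ ⟩
    (- a) * coeff R g (suc i) + coeff R ((1# ∷ []) *ₚ g) i          ≈⟨ +-comm _ _ ⟩
    coeff R ((1# ∷ []) *ₚ g) i + (- a) * coeff R g (suc i)          ≈⟨ +-congʳ (coeff-≈ (oneP-*ₚ g) i) ⟩
    coeff R g i + (- a) * coeff R g (suc i)                          ∎
    where
    no-tail : ∀ i → coeff R (r ∷ []) (suc i) ≈ 0#
    no-tail zero = refl
    no-tail (suc i) = refl

  division : ∀ a p → p ≋ X-minus R a *ₚ quot a p +ₚ (eval p a ∷ [])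
  coeff-≈ (division a []) zero = sym (trans (coeff-divisionForm₀ a [] 0#) (trans (+-identityʳ _) (zeroʳ _)))
  coeff-≈ (division a []) (suc i) = sym (trans (coeff-divisionFormₛ a [] 0# i) (trans (+-identityˡ _) (zeroʳ _)))
  coeff-≈ (division a (c ∷ [])) zero = sym (begin
    coeff R (X-minus R a *ₚ [] +ₚ ((c + a * 0#) ∷ [])) 0  ≈⟨ coeff-divisionForm₀ a [] _ ⟩
    (- a) * 0# + (c + a * 0#)  ≈⟨ +-cong (zeroʳ _) (+-congˡ (zeroʳ a)) ⟩
    0# + (c + 0#)              ≈⟨ trans (+-identityˡ _) (+-identityʳ c) ⟩
    c                          ∎)
  coeff-≈ (division a (c ∷ [])) (suc i) = sym (trans (coeff-divisionFormₛ a [] (c + a * 0#) i) (trans (+-identityˡ _) (zeroʳ _)))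
  coeff-≈ (division a (c ∷ b ∷ p)) zero = sym (begin
    coeff R (X-minus R a *ₚ (r ∷ g) +ₚ ((c + a * r) ∷ [])) 0  ≈⟨ coeff-divisionForm₀ a (r ∷ g) (c + a * r) ⟩
    (- a) * r + (c + a * r)                                  ≈⟨ solve-step ⟩
    c + (a + - a) * r                                        ≈⟨ +-congˡ (trans (*-congʳ (-‿inverseʳ a)) (zeroˡ r)) ⟩
    c + 0#                                                   ≈⟨ +-identityʳ c ⟩
    c                                                        ∎)
    where
    r = eval (b ∷ p) a
    g = quot a (b ∷ p)
    solve-step : (- a) * r + (c + a * r) ≈ c + (a + - a) * r
    solve-step = trans (+-comm _ _) (trans (+-assoc _ _ _) (+-congˡ (sym (distribʳ r a (- a)))))
  coeff-≈ (division a (c ∷ b ∷ p)) (suc i) =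
    trans (coeff-≈ (division a (b ∷ p)) i) (trans (shifted i) (sym (coeff-divisionFormₛ a (r ∷ g) (c + a * r) i)))
    where
    r = eval (b ∷ p) a
    g = quot a (b ∷ p)
    shifted : ∀ i → coeff R (X-minus R a *ₚ g +ₚ (r ∷ [])) i ≈ coeff R (r ∷ g) i + (- a) * coeff R (r ∷ g) (suc i)
    shifted zero = trans (coeff-divisionForm₀ a g r) (+-comm _ _)
    shifted (suc j) = coeff-divisionFormₛ a g r j

  eval-division : ∀ a p x → eval p x ≈ (x - a) * eval (quot a p) x + eval p a
  eval-division a p x = begin
    eval p x                                                       ≈⟨ eval-≋ x (division a p) ⟩
    eval (X-minus R a *ₚ quot a p +ₚ (eval p a ∷ [])) x            ≈⟨ eval-+ₚ (X-minus R a *ₚ quot a p) (eval p a ∷ []) x ⟩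
    eval (X-minus R a *ₚ quot a p) x + (eval p a + x * 0#)         ≈⟨ +-cong (eval-*ₚ (X-minus R a) (quot a p) x) (trans (+-congˡ (zeroʳ x)) (+-identityʳ _)) ⟩
    eval (X-minus R a) x * eval (quot a p) x + eval p a            ≈⟨ +-congʳ (*-congʳ (eval-X-minus a x)) ⟩
    (x - a) * eval (quot a p) x + eval p a                         ∎

  root⇒X-minus-factor : ∀ a p → eval p a ≈ 0# → p ≋ X-minus R a *ₚ quot a p
  coeff-≈ (root⇒X-minus-factor a p pa≈0) i = begin
    coeff R p i                                                             ≈⟨ coeff-≈ (division a p) i ⟩
    coeff R (X-minus R a *ₚ quot a p +ₚ (eval p a ∷ [])) i                  ≈⟨ coeff-+ₚ (X-minus R a *ₚ quot a p) (eval p a ∷ []) i ⟩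
    coeff R (X-minus R a *ₚ quot a p) i + coeff R (eval p a ∷ []) i         ≈⟨ +-congˡ (remainder i) ⟩
    coeff R (X-minus R a *ₚ quot a p) i + 0#                                ≈⟨ +-identityʳ _ ⟩
    coeff R (X-minus R a *ₚ quot a p) i                                     ∎
    where
    remainder : ∀ i → coeff R (eval p a ∷ []) i ≈ 0#
    remainder zero = pa≈0
    remainder (suc zero) = refl
    remainder (suc (suc i)) = refl

  root-of-quot : ∀ {a b} p → eval p a ≈ 0# → ¬ b ≈ a → eval p b ≈ 0# → eval (quot a p) b ≈ 0#
  root-of-quot {a} {b} p pa≈0 b≉a pb≈0 = x*y≈0⇒y≈0 (x≉y⇒x-y≉0 b≉a) (begin
    (b - a) * eval (quot a p) b             ≈⟨ +-identityʳ _ ⟨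
    (b - a) * eval (quot a p) b + 0#        ≈⟨ +-congˡ pa≈0 ⟨
    (b - a) * eval (quot a p) b + eval p a  ≈⟨ eval-division a p b ⟨
    eval p b                                ≈⟨ pb≈0 ⟩
    0#                                      ∎)

  roots⇒IsZero : ∀ d p → length p ℕ.≤ d → (pts : Fin d → Carrier) →
                 (∀ i j → ¬ i ≡ j → ¬ pts i ≈ pts j) → (∀ i → eval p (pts i) ≈ 0#) → IsZero p
  roots⇒IsZero zero [] _ pts distinct roots i = refl
  roots⇒IsZero (suc d) p len pts distinct roots = p≈0
    where
    a = pts Fin.zero
    g = quot a p
    g≈0 : IsZero g
    g≈0 = roots⇒IsZero d g
      (≡.subst (ℕ._≤ d) (≡.sym (length-quot a p)) (ℕ.pred-mono-≤ len))
      (pts ∘ Fin.suc)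
      (λ i j i≢j → distinct (Fin.suc i) (Fin.suc j) (i≢j ∘ Fin.suc-injective))
      (λ i → root-of-quot p (roots Fin.zero) (distinct (Fin.suc i) Fin.zero (λ ())) (roots (Fin.suc i)))
    p≈0 : IsZero p
    p≈0 zero = trans (coeff-≈ (division a p) 0) (trans (coeff-divisionForm₀ a g (eval p a))
      (trans (+-cong (trans (*-congˡ (g≈0 0)) (zeroʳ _)) (roots Fin.zero)) (+-identityʳ _)))
    p≈0 (suc i) = trans (coeff-≈ (division a p) (suc i)) (trans (coeff-divisionFormₛ a g (eval p a) i)
      (trans (+-cong (g≈0 i) (trans (*-congˡ (g≈0 (suc i))) (zeroʳ _))) (+-identityʳ _)))

  x^t≈x-roots-not-distinct : ∀ {t} → 2 ℕ.≤ t → (pts : Fin (suc t) → Carrier) → (∀ i → pts i ^ t ≈ pts i) →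
                             ¬ (∀ i j → ¬ i ≡ j → ¬ pts i ≈ pts j)
  x^t≈x-roots-not-distinct {suc (suc r)} (ℕ.s≤s (ℕ.s≤s ℕ.z≤n)) pts fixed distinct =
    1≉0 (trans (reflexive (≡.sym (coeff-monomial r))) (roots⇒IsZero _ X^t-X length-X^t-X pts distinct roots (suc (suc r))))
    where
    X^t-X : Poly R
    X^t-X = 0# ∷ (- 1#) ∷ monomial R 1# r
    eval-X^t-X : ∀ y → eval X^t-X y ≈ y ^ suc (suc r) - y
    eval-X^t-X y = begin
      0# + y * (- 1# + y * eval (monomial R 1# r) y)  ≈⟨ +-identityˡ _ ⟩
      y * (- 1# + y * eval (monomial R 1# r) y)       ≈⟨ *-congˡ (+-congˡ (*-congˡ (trans (eval-monomial 1# r y) (*-identityʳ _)))) ⟩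
      y * (- 1# + y * y ^ r)                          ≈⟨ distribˡ _ _ _ ⟩
      y * - 1# + y * (y * y ^ r)                      ≈⟨ +-comm _ _ ⟩
      y ^ suc (suc r) + y * - 1#                      ≈⟨ +-congˡ (trans (sym (-‿distribʳ-* y 1#)) (-‿cong (*-identityʳ y))) ⟩
      y ^ suc (suc r) - y                             ∎
      where open import Algebra.Properties.Ring ring using (-‿distribʳ-*)
    roots : ∀ i → eval X^t-X (pts i) ≈ 0#
    roots i = trans (eval-X^t-X (pts i)) (x≈y⇒x∙y⁻¹≈ε (fixed i))
    coeff-monomial : ∀ r → coeff R (monomial R 1# r) r ≡ 1#
    coeff-monomial zero = ≡.refl
    coeff-monomial (suc r) = coeff-monomial r
    length-X^t-X : length X^t-X ℕ.≤ suc (suc (suc r))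
    length-X^t-X = ℕ.≤-reflexive (≡.cong (suc ∘ suc)
      (≡.trans (List.length-++ (replicate r 0#)) (≡.trans (≡.cong (ℕ._+ 1) (List.length-replicate r)) (ℕ.+-comm r 1))))

  module _ {A : Set} (g : A → Carrier) where

    ∏X-minus : List A → Poly R
    ∏X-minus vs = prodP R (map (λ v → X-minus R (g v)) vs)

    roots⇒∏X-minus-∣ : ∀ vs → AllPairs (λ v w → ¬ g v ≈ g w) vs →
                       ∀ p → All (λ v → eval p (g v) ≈ 0#) vs → _∣P_ R (∏X-minus vs) p
    roots⇒∏X-minus-∣ [] _ p _ = p , coeff-≈ (≋-sym (oneP-*ₚ p))
    roots⇒∏X-minus-∣ (v ∷ vs) (v≉vs ∷ distinct) p (pv≈0 ∷ roots)
      with h , quot≈ ← roots⇒∏X-minus-∣ vs distinct (quot (g v) p)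
                        (All.zipWith (λ (v≉w , pw≈0) → root-of-quot p pv≈0 (v≉w ∘ sym) pw≈0) (v≉vs , roots))
      = h , coeff-≈ (≋-trans (root⇒X-minus-factor (g v) p pv≈0)
              (≋-trans (*ₚ-congˡ (X-minus R (g v)) (mk≋ quot≈)) (≋-sym (*ₚ-assoc (X-minus R (g v)) (∏X-minus vs) h))))

    ∏X-minus-root : ∀ vs x → Any (λ w → g w ≈ x) vs → eval (∏X-minus vs) x ≈ 0#
    ∏X-minus-root (v ∷ vs) x v∈ = trans (eval-*ₚ (X-minus R (g v)) (∏X-minus vs) x) (factor-zero v∈)
      where
      factor-zero : Any (λ w → g w ≈ x) (v ∷ vs) → eval (X-minus R (g v)) x * eval (∏X-minus vs) x ≈ 0#
      factor-zero (here gv≈x) =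
        trans (*-congʳ (trans (eval-X-minus (g v) x) (x≈y⇒x∙y⁻¹≈ε (sym gv≈x)))) (zeroˡ _)
      factor-zero (there w∈) = trans (*-congˡ (∏X-minus-root vs x w∈)) (zeroʳ _)

IsEnumeration : {A : Set} → Rel A 0ℓ → (N : ℕ) → (Fin N → A) → Set
IsEnumeration _≈_ N E = (∀ i j → E i ≈ E j → i ≡ j) Product.× (∀ x → ∃ λ i → x ≈ E i)

Fin-injective⇒surjective : ∀ {N} (f : Fin N → Fin N) → (∀ x y → f x ≡ f y → x ≡ y) → ∀ y → ∃ λ x → f x ≡ y
Fin-injective⇒surjective {suc N} f f-inj y with Fin.any? (λ x → f x Fin.≟ y)
... | yes y∈im = y∈im
... | no y∉im = ⊥-elim (ℕ.1+n≰n (Fin.injective⇒≤ {f = λ x → Fin.punchOut (y≢f x)}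
        (λ eq → f-inj _ _ (Fin.punchOut-injective (y≢f _) (y≢f _) eq))))
  where
  y≢f : ∀ x → ¬ y ≡ f x
  y≢f x y≡fx = y∉im (x , ≡.sym y≡fx)

module Enumeration (S : Setoid 0ℓ 0ℓ) {N} {E : Fin N → Setoid.Carrier S}
                   (isEnum : IsEnumeration (Setoid._≈_ S) N E) where
  open Setoid S

  E-injective : ∀ i j → E i ≈ E j → i ≡ j
  E-injective = proj₁ isEnum

  index : Carrier → Fin N
  index x = proj₁ (proj₂ isEnum x)

  E-index : ∀ x → x ≈ E (index x)
  E-index x = proj₂ (proj₂ isEnum x)

  index-injective : ∀ {x y} → index x ≡ index y → x ≈ y
  index-injective {x} {y} eq = trans (E-index x) (trans (reflexive (≡.cong E eq)) (sym (E-index y)))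

  index-cong : ∀ {x y} → x ≈ y → index x ≡ index y
  index-cong {x} {y} x≈y = E-injective _ _ (trans (sym (E-index x)) (trans x≈y (E-index y)))

  index-E : ∀ i → index (E i) ≡ i
  index-E i = E-injective _ _ (sym (E-index (E i)))

  infix 4 _≟_
  _≟_ : Decidable _≈_
  x ≟ y with index x Fin.≟ index y
  ... | yes eq = yes (index-injective eq)
  ... | no neq = no (neq ∘ index-cong)

  injective⇒surjective : (f : Carrier → Carrier) → (∀ x y → f x ≈ f y → x ≈ y) → ∀ y → ∃ λ x → f x ≈ y
  injective⇒surjective f f-inj y
    with i , eq ← Fin-injective⇒surjective (index ∘ f ∘ E)
                    (λ i j eq → E-injective i j (f-inj _ _ (index-injective eq))) (index y)
    = E i , index-injective eq

enumeration-transport : ∀ {A : Set} {_≈_ : Rel A 0ℓ} (T : Setoid 0ℓ 0ℓ) {N E} → IsEnumeration _≈_ N E →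
  (g : A → Setoid.Carrier T) → (∀ {x y} → x ≈ y → Setoid._≈_ T (g x) (g y)) →
  (∀ x y → Setoid._≈_ T (g x) (g y) → x ≈ y) → (∀ y → ∃ λ x → Setoid._≈_ T y (g x)) →
  IsEnumeration (Setoid._≈_ T) N (g ∘ E)
enumeration-transport T (E-inj , E-surj) g g-cong g-inj g-surj =
    (λ i j eq → E-inj i j (g-inj _ _ eq))
  , λ y → let (x , y≈gx) = g-surj y; (i , x≈Ei) = E-surj x in i , Setoid.trans T y≈gx (g-cong x≈Ei)

module _ (S : Setoid 0ℓ 0ℓ) where
  open Setoid S
  open import Data.Vec.Functional.Relation.Binary.Equality.Setoid S using (_≋_)

  funToFin-cong : ∀ {m M} {f g : Fin m → Fin M} → (∀ j → f j ≡ g j) → Fin.funToFin f ≡ Fin.funToFin g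
  funToFin-cong {zero} f≗g = ≡.refl
  funToFin-cong {suc m} f≗g = ≡.cong₂ Fin.combine (f≗g Fin.zero) (funToFin-cong (f≗g ∘ Fin.suc))

  enumeration-→ : ∀ {N E} m → IsEnumeration _≈_ N E →
                  IsEnumeration (_≋_ {m}) (N ℕ.^ m) (λ i j → E (Fin.finToFun i j))
  enumeration-→ {N} {E} m isEnum = injective , surjective
    where
    open Enumeration S isEnum
    injective : ∀ i i′ → (∀ j → E (Fin.finToFun i j) ≈ E (Fin.finToFun i′ j)) → i ≡ i′
    injective i i′ eq = begin
      i                               ≡⟨ Fin.funToFin-finToFin {m} {N} i ⟨
      Fin.funToFin (Fin.finToFun {N} {m} i)   ≡⟨ funToFin-cong (λ j → E-injective _ _ (eq j)) ⟩
      Fin.funToFin (Fin.finToFun {N} {m} i′)  ≡⟨ Fin.funToFin-finToFin {m} {N} i′ ⟩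
      i′                              ∎
      where open ≡.≡-Reasoning
    surjective : ∀ f → ∃ λ i → ∀ j → f j ≈ E (Fin.finToFun i j)
    surjective f = Fin.funToFin (index ∘ f) ,
      λ j → trans (E-index (f j)) (reflexive (≡.cong E (≡.sym (Fin.finToFun-funToFin (index ∘ f) j))))

module FiniteField (R : CommutativeRing 0ℓ 0ℓ) (isField : IsField R)
                   {N} {E : Fin N → CommutativeRing.Carrier R} (hasCard : HasCard R N E) where
  open CommutativeRing R hiding (zero)
  open FieldPolynomials R isField
  open Enumeration setoid hasCard public
  open import Relation.Binary.Reasoning.Setoid setoid
  open import Algebra.Properties.Semiring.Exp semiring using (_^_)
  open import Algebra.Properties.CommutativeMonoid.Sum *-commutativeMonoid
    using (sum-permute; ∑-distrib-+; sum-remove; sum-cong-≋; sum-replicate-zero) renaming (sum to ∏)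

  2≤N : 2 ℕ.≤ N
  2≤N = Fin.injective⇒≤ {f = index ∘ zeroOrOne} λ {i} {j} → zeroOrOne-injective i j ∘ index-injective
    where
    zeroOrOne : Fin 2 → Carrier
    zeroOrOne Fin.zero = 0#
    zeroOrOne (Fin.suc _) = 1#
    zeroOrOne-injective : ∀ i j → zeroOrOne i ≈ zeroOrOne j → i ≡ j
    zeroOrOne-injective Fin.zero Fin.zero _ = ≡.refl
    zeroOrOne-injective Fin.zero (Fin.suc Fin.zero) 0≈1 = ⊥-elim (1≉0 (sym 0≈1))
    zeroOrOne-injective (Fin.suc Fin.zero) Fin.zero 1≈0 = ⊥-elim (1≉0 1≈0)
    zeroOrOne-injective (Fin.suc Fin.zero) (Fin.suc Fin.zero) _ = ≡.refl

  ∏-≉0 : ∀ {n} (f : Fin n → Carrier) → (∀ i → ¬ f i ≈ 0#) → ¬ ∏ f ≈ 0#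
  ∏-≉0 {zero} f f≉0 = 1≉0
  ∏-≉0 {suc n} f f≉0 = *-≉0 (f≉0 Fin.zero) (∏-≉0 (f ∘ Fin.suc) (f≉0 ∘ Fin.suc))

  ∏-const : ∀ n c → ∏ {n} (λ _ → c) ≈ c ^ n
  ∏-const zero c = refl
  ∏-const (suc n) c = *-congˡ (∏-const n c)

  ∏-single : ∀ {n} (f : Fin n → Carrier) j → (∀ i → ¬ i ≡ j → f i ≈ 1#) → ∏ f ≈ f j
  ∏-single {suc n} f j f≈1 = begin
    ∏ f                                      ≈⟨ sum-remove {i = j} f ⟩
    f j * ∏ (λ k → f (Fin.punchIn j k))      ≈⟨ *-congˡ (trans (sum-cong-≋ (λ k → f≈1 _ (Fin.punchInᵢ≢i j k))) (sum-replicate-zero n)) ⟩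
    f j * 1#                                 ≈⟨ *-identityʳ _ ⟩
    f j                                      ∎

  -- Lagrange: the product P of all nonzero elements satisfies x^N P = P x,
  -- since multiplication by a nonzero x permutes the elements and fixes 0.
  nonzeroOr1 : Carrier → Carrier
  nonzeroOr1 y with y ≟ 0#
  ... | yes _ = 1#
  ... | no _ = y

  nonzeroOr1-≉0 : ∀ y → ¬ nonzeroOr1 y ≈ 0#
  nonzeroOr1-≉0 y with y ≟ 0#
  ... | yes _ = 1≉0
  ... | no y≉0 = y≉0

  nonzeroOr1-cong : ∀ {y y′} → y ≈ y′ → nonzeroOr1 y ≈ nonzeroOr1 y′
  nonzeroOr1-cong {y} {y′} y≈y′ with y ≟ 0# | y′ ≟ 0#
  ... | yes _ | yes _ = refl
  ... | yes y≈0 | no y′≉0 = ⊥-elim (y′≉0 (trans (sym y≈y′) y≈0))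
  ... | no y≉0 | yes y′≈0 = ⊥-elim (y≉0 (trans y≈y′ y′≈0))
  ... | no _ | no _ = y≈y′

  module _ {x : Carrier} (x≉0 : ¬ x ≈ 0#) where

    x·_ : Permutation N N
    x·_ = permutation (λ i → index (x * E i)) (λ j → index (x≉0 ⁻¹ * E j))
      (λ j → E-injective _ _ (trans (sym (E-index _)) (trans (*-congˡ (sym (E-index _))) (cancel x (x≉0 ⁻¹) (*-inverseʳ x≉0)))))
      (λ i → E-injective _ _ (trans (sym (E-index _)) (trans (*-congˡ (sym (E-index _))) (cancel (x≉0 ⁻¹) x (trans (*-comm _ _) (*-inverseʳ x≉0))))))
      where
      cancel : ∀ a b → a * b ≈ 1# → ∀ {y} → a * (b * y) ≈ y
      cancel a b ab≈1 {y} = trans (sym (*-assoc _ _ _)) (trans (*-congʳ ab≈1) (*-identityˡ y))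

    xIfZero : Fin N → Carrier
    xIfZero i with E i ≟ 0#
    ... | yes _ = x
    ... | no _ = 1#

    x*nonzeroOr1 : ∀ i → x * nonzeroOr1 (E i) ≈ nonzeroOr1 (x * E i) * xIfZero i
    x*nonzeroOr1 i with E i ≟ 0# | x * E i ≟ 0#
    ... | yes _ | yes _ = trans (*-identityʳ x) (sym (*-identityˡ x))
    ... | yes Ei≈0 | no xEi≉0 = ⊥-elim (xEi≉0 (trans (*-congˡ Ei≈0) (zeroʳ x)))
    ... | no Ei≉0 | yes xEi≈0 = ⊥-elim (*-≉0 x≉0 Ei≉0 xEi≈0)
    ... | no _ | no _ = sym (*-identityʳ _)

    ∏xIfZero : ∏ xIfZero ≈ x
    ∏xIfZero = trans (∏-single xIfZero (index 0#) others) at-zero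
      where
      others : ∀ i → ¬ i ≡ index 0# → xIfZero i ≈ 1#
      others i i≢0 with E i ≟ 0#
      ... | yes Ei≈0 = ⊥-elim (i≢0 (≡.trans (≡.sym (index-E i)) (index-cong Ei≈0)))
      ... | no _ = refl
      at-zero : xIfZero (index 0#) ≈ x
      at-zero with E (index 0#) ≟ 0#
      ... | yes _ = refl
      ... | no E0≉0 = ⊥-elim (E0≉0 (sym (E-index 0#)))

    x^N≈x-nonzero : x ^ N ≈ x
    x^N≈x-nonzero = x∙y⁻¹≈ε⇒x≈y _ _ (x*y≈0⇒y≈0 (∏-≉0 _ (nonzeroOr1-≉0 ∘ E)) (begin
      P * (x ^ N - x)          ≈⟨ x[y-z]≈xy-xz P _ x ⟩
      P * x ^ N - P * x        ≈⟨ +-congʳ (trans (*-comm _ _) x^NP≈Px) ⟩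
      P * x - P * x            ≈⟨ -‿inverseʳ _ ⟩
      0#                       ∎))
      where
      open import Algebra.Properties.Ring ring using (x∙y⁻¹≈ε⇒x≈y; x[y-z]≈xy-xz)
      P = ∏ (nonzeroOr1 ∘ E)
      x^NP≈Px : x ^ N * P ≈ P * x
      x^NP≈Px = begin
        x ^ N * P                                        ≈⟨ *-congʳ (∏-const N x) ⟨
        ∏ {N} (λ _ → x) * P                                ≈⟨ ∑-distrib-+ {N} (λ _ → x) (nonzeroOr1 ∘ E) ⟨
        ∏ (λ i → x * nonzeroOr1 (E i))                   ≈⟨ sum-cong-≋ x*nonzeroOr1 ⟩
        ∏ (λ i → nonzeroOr1 (x * E i) * xIfZero i)        ≈⟨ ∑-distrib-+ {N} (λ i → nonzeroOr1 (x * E i)) xIfZero ⟩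
        ∏ (λ i → nonzeroOr1 (x * E i)) * ∏ xIfZero        ≈⟨ *-cong (sum-cong-≋ (λ i → nonzeroOr1-cong (E-index (x * E i)))) ∏xIfZero ⟩
        ∏ (λ i → nonzeroOr1 (E (index (x * E i)))) * x    ≈⟨ *-congʳ (sum-permute (nonzeroOr1 ∘ E) x·_) ⟨
        P * x                                            ∎

  x^N≈x : ∀ x → x ^ N ≈ x
  x^N≈x x with x ≟ 0#
  ... | no x≉0 = x^N≈x-nonzero x≉0
  ... | yes x≈0 = positive-power-of-0 (index 0#) x≈0
    where
    positive-power-of-0 : ∀ {k} → Fin k → ∀ {y} → y ≈ 0# → y ^ k ≈ y
    positive-power-of-0 {suc k} _ y≈0 = trans (*-congʳ y≈0) (trans (zeroˡ _) (sym y≈0))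

module _ (q : ℕ) where

  allVecs-complete : ∀ m (c : Fin m → Fin q) → Any (λ v → ∀ j → v j ≡ c j) (allVecs q m)
  allVecs-complete zero c = here (λ ())
  allVecs-complete (suc m) c = Any.concatMap⁺ _
    (Any.map (λ {v} v≗c → Any.map⁺ (Any.map (λ {k} c₀≡k → extend v k c₀≡k v≗c) (∈-allFin (c Fin.zero))))
             (allVecs-complete m (c ∘ Fin.suc)))
    where
    extend : ∀ v k → c Fin.zero ≡ k → (∀ j → v j ≡ c (Fin.suc j)) → ∀ j → _
    extend v k c₀≡k v≗c Fin.zero = ≡.sym c₀≡k
    extend v k c₀≡k v≗c (Fin.suc j) = v≗c j

  Differ : ∀ {m} → (Fin m → Fin q) → (Fin m → Fin q) → Set
  Differ v w = ∃ λ j → ¬ v j ≡ w j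

  allVecs-distinct : ∀ m → AllPairs Differ (allVecs q m)
  allVecs-distinct zero = [] ∷ []
  allVecs-distinct (suc m) =
    AllPairs.concat⁺ (All.map⁺ (All.universal differentHeads _)) (AllPairs.map⁺ (AllPairs.map differentTails (allVecs-distinct m)))
    where
    differentHeads : ∀ v → AllPairs Differ (map _ (allFin q))
    differentHeads v = AllPairs.map⁺ (AllPairs.map (Fin.zero ,_) (allFin⁺ q))
    differentTails : ∀ {v w} → Differ v w → All (λ a → All (Differ a) (map _ (allFin q))) (map _ (allFin q))
    differentTails (j , vj≢wj) = All.map⁺ (All.universal (λ _ → All.map⁺ (All.universal (λ _ → Fin.suc j , vj≢wj) _)) _)

module Sums (R : CommutativeRing 0ℓ 0ℓ) where
  open CommutativeRing R hiding (zero)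
  open import Algebra.Properties.Ring ring using (-0#≈0#; -‿+-comm)
  open import Algebra.Properties.CommutativeSemigroup +-commutativeSemigroup using () renaming (interchange to +-interchange)

  ∑ : ∀ {k} → (Fin k → Carrier) → Carrier
  ∑ = sumF R

  ∑-cong : ∀ {k} {f g : Fin k → Carrier} → (∀ j → f j ≈ g j) → ∑ f ≈ ∑ g
  ∑-cong {zero} f≈g = refl
  ∑-cong {suc k} f≈g = +-cong (f≈g Fin.zero) (∑-cong (f≈g ∘ Fin.suc))

  ∑-+ : ∀ {k} (f g : Fin k → Carrier) → ∑ (λ j → f j + g j) ≈ ∑ f + ∑ g
  ∑-+ {zero} f g = sym (+-identityʳ _)
  ∑-+ {suc k} f g = trans (+-congˡ (∑-+ (f ∘ Fin.suc) (g ∘ Fin.suc)))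
    (+-interchange (f Fin.zero) (g Fin.zero) (∑ (f ∘ Fin.suc)) (∑ (g ∘ Fin.suc)))

  ∑-neg : ∀ {k} (f : Fin k → Carrier) → ∑ (λ j → - f j) ≈ - ∑ f
  ∑-neg {zero} f = sym -0#≈0#
  ∑-neg {suc k} f = trans (+-congˡ (∑-neg (f ∘ Fin.suc))) (-‿+-comm _ _)

  ∑-- : ∀ {k} (f g : Fin k → Carrier) → ∑ (λ j → f j - g j) ≈ ∑ f - ∑ g
  ∑-- f g = trans (∑-+ f (λ j → - g j)) (+-congˡ (∑-neg g))

  *-distribˡ-∑ : ∀ {k} c (f : Fin k → Carrier) → c * ∑ f ≈ ∑ (λ j → c * f j)
  *-distribˡ-∑ {zero} c f = zeroʳ c
  *-distribˡ-∑ {suc k} c f = trans (distribˡ _ _ _) (+-congˡ (*-distribˡ-∑ c (f ∘ Fin.suc)))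

  ∑-zero : ∀ {k} (f : Fin k → Carrier) → (∀ j → f j ≈ 0#) → ∑ f ≈ 0#
  ∑-zero {zero} f f≈0 = refl
  ∑-zero {suc k} f f≈0 = trans (+-cong (f≈0 Fin.zero) (∑-zero (f ∘ Fin.suc) (f≈0 ∘ Fin.suc))) (+-identityʳ _)

  ∑-single : ∀ {k} (f : Fin k → Carrier) j → (∀ i → ¬ i ≡ j → f i ≈ 0#) → ∑ f ≈ f j
  ∑-single {suc k} f Fin.zero f≈0 =
    trans (+-congˡ (∑-zero (f ∘ Fin.suc) (λ i → f≈0 (Fin.suc i) (λ ())))) (+-identityʳ _)
  ∑-single {suc k} f (Fin.suc j) f≈0 =
    trans (+-cong (f≈0 Fin.zero (λ ())) (∑-single (f ∘ Fin.suc) j (λ i i≢j → f≈0 (Fin.suc i) (i≢j ∘ Fin.suc-injective))))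
      (+-identityˡ _)

module Extension (K F : CommutativeRing 0ℓ 0ℓ) (ι : CommutativeRing.Carrier K → CommutativeRing.Carrier F)
                 (hom : IsRingHom K F ι) where
  private module K = CommutativeRing K
  open CommutativeRing F hiding (zero)
  open RingMorphisms.IsRingHomomorphism hom public using (⟦⟧-cong; 0#-homo; 1#-homo; -‿homo)
  open RingMorphisms.IsRingHomomorphism hom using () renaming (+-homo to ι-+)
  open Sums F
  open import Relation.Binary.Reasoning.Setoid setoid
  open import Algebra.Properties.Ring ring using (x≈y⇒x∙y⁻¹≈ε; x+x≈x⇒x≈0; [y-z]x≈yx-zx)
  open import Function.Endo.Propositional Carrier using () renaming (_^_ to _∘^_)

  ι-- : ∀ a b → ι (a K.- b) ≈ ι a - ι b
  ι-- a b = trans (ι-+ a (K.- b)) (+-congˡ (-‿homo b))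

  linComb-congˡ : ∀ {k} {c c′ : Fin k → K.Carrier} (w : Fin k → Carrier) →
                  (∀ j → c j K.≈ c′ j) → linComb K F ι c w ≈ linComb K F ι c′ w
  linComb-congˡ w c≈c′ = ∑-cong (λ j → *-congʳ (⟦⟧-cong (c≈c′ j)))

  linComb-congʳ : ∀ {k} (c : Fin k → K.Carrier) {w w′ : Fin k → Carrier} →
                  (∀ j → w j ≈ w′ j) → linComb K F ι c w ≈ linComb K F ι c w′
  linComb-congʳ c w≈w′ = ∑-cong (λ j → *-congˡ (w≈w′ j))

  linComb-- : ∀ {k} (c c′ : Fin k → K.Carrier) w →
              linComb K F ι (λ j → c j K.- c′ j) w ≈ linComb K F ι c w - linComb K F ι c′ w
  linComb-- c c′ w =
    trans (∑-cong (λ j → trans (*-congʳ (ι-- (c j) (c′ j))) ([y-z]x≈yx-zx (w j) _ _))) (∑-- (λ j → ι (c j) * w j) (λ j → ι (c′ j) * w j))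

  δ : ∀ {k} → Fin k → Fin k → K.Carrier
  δ j i with i Fin.≟ j
  ... | yes _ = K.1#
  ... | no _ = K.0#

  linComb-δ : ∀ {k} (w : Fin k → Carrier) (j : Fin k) → linComb K F ι (δ j) w ≈ w j
  linComb-δ w j = trans (∑-single _ j off) on
    where
    off : ∀ i → ¬ i ≡ j → ι (δ j i) * w i ≈ 0#
    off i i≢j with i Fin.≟ j
    ... | yes i≡j = ⊥-elim (i≢j i≡j)
    ... | no _ = trans (*-congʳ 0#-homo) (zeroˡ _)
    on : ι (δ j j) * w j ≈ w j
    on with j Fin.≟ j
    ... | yes _ = trans (*-congʳ 1#-homo) (*-identityˡ _)
    ... | no j≢j = ⊥-elim (j≢j ≡.refl)

  LinIndep⇒linComb-injective : ∀ {k} {w : Fin k → Carrier} → LinIndep K F ι w →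
                              ∀ c c′ → linComb K F ι c w ≈ linComb K F ι c′ w → ∀ j → c j K.≈ c′ j
  LinIndep⇒linComb-injective {w = w} indep c c′ eq j =
    KRing.x∙y⁻¹≈ε⇒x≈y _ _ (indep _ (trans (linComb-- c c′ w) (x≈y⇒x∙y⁻¹≈ε eq)) j)
    where module KRing = Algebra.Properties.Ring K.ring

  record IsKLinear (f : Carrier → Carrier) : Set where
    field
      cong        : ∀ {x y} → x ≈ y → f x ≈ f y
      additive    : ∀ x y → f (x + y) ≈ f x + f y
      homogeneous : ∀ c x → f (ι c * x) ≈ ι c * f x

    f0≈0 : f 0# ≈ 0#
    f0≈0 = x+x≈x⇒x≈0 (f 0#) (trans (sym (additive 0# 0#)) (cong (+-identityʳ 0#)))

    linComb-homo : ∀ {k} (c : Fin k → K.Carrier) w → f (linComb K F ι c w) ≈ linComb K F ι c (f ∘ w)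
    linComb-homo {zero} c w = f0≈0
    linComb-homo {suc k} c w =
      trans (additive _ _) (+-cong (homogeneous _ _) (linComb-homo (c ∘ Fin.suc) (w ∘ Fin.suc)))

    vanishes-on-span : ∀ {k} {w : Fin k → Carrier} → (∀ j → f (w j) ≈ 0#) → ∀ c → f (linComb K F ι c w) ≈ 0#
    vanishes-on-span {w = w} fw≈0 c =
      trans (linComb-homo c w) (∑-zero _ (λ j → trans (*-congˡ (fw≈0 j)) (zeroʳ _)))

  private module Lin = IsKLinear

  IsKLinear-resp : ∀ {f g} → (∀ x → f x ≈ g x) → IsKLinear f → IsKLinear g
  IsKLinear-resp f≈g lin = record
    { cong        = λ x≈y → trans (sym (f≈g _)) (trans (Lin.cong lin x≈y) (f≈g _))
    ; additive    = λ x y → trans (sym (f≈g _)) (trans (Lin.additive lin x y) (+-cong (f≈g x) (f≈g y)))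
    ; homogeneous = λ c x → trans (sym (f≈g _)) (trans (Lin.homogeneous lin c x) (*-congˡ (f≈g x)))
    }

  IsKLinear-0 : IsKLinear (λ _ → 0#)
  IsKLinear-0 = record
    { cong = λ _ → refl ; additive = λ _ _ → sym (+-identityʳ _) ; homogeneous = λ _ _ → sym (zeroʳ _) }

  IsKLinear-+ : ∀ {f g} → IsKLinear f → IsKLinear g → IsKLinear (λ x → f x + g x)
  IsKLinear-+ {f} {g} linf ling = record
    { cong        = λ x≈y → +-cong (Lin.cong linf x≈y) (Lin.cong ling x≈y)
    ; additive    = λ x y → trans (+-cong (Lin.additive linf x y) (Lin.additive ling x y)) (+-interchange (f x) (f y) (g x) (g y))
    ; homogeneous = λ c x → trans (+-cong (Lin.homogeneous linf c x) (Lin.homogeneous ling c x)) (sym (distribˡ _ _ _))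
    }
    where open import Algebra.Properties.CommutativeSemigroup +-commutativeSemigroup using () renaming (interchange to +-interchange)

  IsKLinear-- : ∀ {f g} → IsKLinear f → IsKLinear g → IsKLinear (λ x → f x - g x)
  IsKLinear-- {f} {g} linf ling = IsKLinear-+ linf (record
    { cong        = λ x≈y → -‿cong (Lin.cong ling x≈y)
    ; additive    = λ x y → trans (-‿cong (Lin.additive ling x y)) (sym (-‿+-comm _ _))
    ; homogeneous = λ c x → trans (-‿cong (Lin.homogeneous ling c x)) (-‿distribʳ-* _ _)
    })
    where open import Algebra.Properties.Ring ring using (-‿+-comm; -‿distribʳ-*)

  IsKLinear-∑ : ∀ {k} (f : Fin k → Carrier → Carrier) → (∀ j → IsKLinear (f j)) → IsKLinear (λ x → ∑ (λ j → f j x))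
  IsKLinear-∑ {zero} f lin = IsKLinear-0
  IsKLinear-∑ {suc k} f lin = IsKLinear-+ (lin Fin.zero) (IsKLinear-∑ (f ∘ Fin.suc) (lin ∘ Fin.suc))

  record IsKEndomorphism (g : Carrier → Carrier) : Set where
    field
      cong           : ∀ {x y} → x ≈ y → g x ≈ g y
      additive       : ∀ x y → g (x + y) ≈ g x + g y
      multiplicative : ∀ x y → g (x * y) ≈ g x * g y
      fixes-K        : ∀ c → g (ι c) ≈ ι c

    g0≈0 : g 0# ≈ 0#
    g0≈0 = trans (cong (sym 0#-homo)) (trans (fixes-K K.0#) 0#-homo)

    g1≈1 : g 1# ≈ 1#
    g1≈1 = trans (cong (sym 1#-homo)) (trans (fixes-K K.1#) 1#-homo)

    g-neg : ∀ x → g (- x) ≈ - g x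
    g-neg x = +-inverseˡ-unique (g (- x)) (g x)
      (trans (sym (additive (- x) x)) (trans (cong (-‿inverseˡ x)) g0≈0))
      where open import Algebra.Properties.Ring ring using (+-inverseˡ-unique)

    g-- : ∀ x y → g (x - y) ≈ g x - g y
    g-- x y = trans (additive x (- y)) (+-congˡ (g-neg y))

    scaled-IsKLinear : ∀ c → IsKLinear (λ x → c * g x)
    scaled-IsKLinear c = record
      { cong        = λ x≈y → *-congˡ (cong x≈y)
      ; additive    = λ x y → trans (*-congˡ (additive x y)) (distribˡ _ _ _)
      ; homogeneous = λ c′ x → trans (*-congˡ (trans (multiplicative _ _) (*-congʳ (fixes-K c′)))) (x∙yz≈y∙xz c _ _)
      }
      where open import Algebra.Properties.CommutativeSemigroup *-commutativeSemigroup using (x∙yz≈y∙xz)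

    linComb-homo : ∀ {k} (c : Fin k → K.Carrier) w → g (linComb K F ι c w) ≈ linComb K F ι c (g ∘ w)
    linComb-homo = IsKLinear.linComb-homo (IsKLinear-resp (λ x → *-identityˡ (g x)) (scaled-IsKLinear 1#))

  IsKEndomorphism-∘^ : ∀ {g} → IsKEndomorphism g → ∀ j → IsKEndomorphism (g ∘^ j)
  IsKEndomorphism-∘^ endo zero = record
    { cong = λ x≈y → x≈y ; additive = λ _ _ → refl ; multiplicative = λ _ _ → refl ; fixes-K = λ _ → refl }
  IsKEndomorphism-∘^ endo (suc j) = record
    { cong           = λ x≈y → E.cong (Eʲ.cong x≈y)
    ; additive       = λ x y → trans (E.cong (Eʲ.additive x y)) (E.additive _ _)
    ; multiplicative = λ x y → trans (E.cong (Eʲ.multiplicative x y)) (E.multiplicative _ _)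
    ; fixes-K        = λ c → trans (E.cong (Eʲ.fixes-K c)) (E.fixes-K c)
    }
    where
    module E = IsKEndomorphism endo
    module Eʲ = IsKEndomorphism (IsKEndomorphism-∘^ endo j)

module BinomialCoefficients (R : CommutativeRing 0ℓ 0ℓ) (isField : IsField R)
                            {k} {E : Fin (suc k) → CommutativeRing.Carrier R} (hasCard : HasCard R (suc k) E) where
  open CommutativeRing R hiding (zero)
  open Polynomials R
  open FieldPolynomials R isField using (roots⇒IsZero)
  open FiniteField R isField hasCard using (x^N≈x)
  open import Relation.Binary.Reasoning.Setoid setoid
  open import Algebra.Properties.Ring ring using (-0#≈0#)
  open import Algebra.Properties.Semiring.Exp semiring using (_^_; ^-congʳ)
  open import Algebra.Properties.Semiring.Mult semiring using (_×_; ×-congʳ; ×-cong)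
  open import Algebra.Properties.Semiring.Sum semiring using (sum; sum-cong-≋; sum-init-last; *-distribˡ-sum)
  import Algebra.Properties.CommutativeSemiring.Binomial commutativeSemiring as Binomial

  private
    q = suc k

  1^ : ∀ n → 1# ^ n ≈ 1#
  1^ zero = refl
  1^ (suc n) = trans (*-identityˡ _) (1^ n)

  coeff-tabulate : ∀ {n} (g : Fin n → Carrier) (j : Fin n) → coeff R (tabulate g) (Fin.toℕ j) ≡ g j
  coeff-tabulate g Fin.zero = ≡.refl
  coeff-tabulate g (Fin.suc j) = coeff-tabulate (g ∘ Fin.suc) j

  eval-tabulate : ∀ {n} (g : Fin n → Carrier) y → eval (tabulate g) y ≈ sum (λ j → g j * y ^ Fin.toℕ j)
  eval-tabulate {zero} g y = refl
  eval-tabulate {suc n} g y = +-cong (sym (*-identityʳ _)) (begin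
    y * eval (tabulate (g ∘ Fin.suc)) y                        ≈⟨ *-congˡ (eval-tabulate (g ∘ Fin.suc) y) ⟩
    y * sum (λ j → g (Fin.suc j) * y ^ Fin.toℕ j)             ≈⟨ *-distribˡ-sum {n} y _ ⟩
    sum (λ j → y * (g (Fin.suc j) * y ^ Fin.toℕ j))           ≈⟨ sum-cong-≋ {n} (λ j → x∙yz≈y∙xz y _ _) ⟩
    sum (λ j → g (Fin.suc j) * y ^ suc (Fin.toℕ j))           ∎)
    where open import Algebra.Properties.CommutativeSemigroup *-commutativeSemigroup using (x∙yz≈y∙xz)

  -- Σ_{j<q} (q choose j) X^j = (X + 1)^q - X^q takes the value 1 at all q points (Lagrange),
  -- so binomialPoly - 1, having only q coefficients, is zero.
  binomialCoeff : Fin q → Carrier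
  binomialCoeff j = (q C Fin.toℕ j) × 1#

  binomialPoly : Poly R
  binomialPoly = tabulate binomialCoeff

  eval-binomialPoly : ∀ y → (y + 1#) ^ q ≈ eval binomialPoly y + y ^ q
  eval-binomialPoly y = begin
    (y + 1#) ^ q                                                         ≈⟨ Binomial.theorem q y 1# ⟩
    sum (Binomial.binomialTerm y 1# q)                                   ≈⟨ sum-init-last (Binomial.binomialTerm y 1# q) ⟩
    sum (λ j → Binomial.binomialTerm y 1# q (Fin.inject₁ j)) + top        ≈⟨ +-cong (sum-cong-≋ {q} lower) (top≈ (Fin.toℕ (Fin.fromℕ q)) (Fin.toℕ-fromℕ q)) ⟩
    sum {q} (λ j → binomialCoeff j * y ^ Fin.toℕ j) + y ^ q               ≈⟨ +-congʳ (eval-tabulate binomialCoeff y) ⟨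
    eval binomialPoly y + y ^ q                                          ∎
    where
    top = Binomial.binomialTerm y 1# q (Fin.fromℕ q)
    term : ∀ i → (q C i) × (y ^ i * 1# ^ (q ∸ i)) ≈ (q C i) × 1# * y ^ i
    term i = begin
      (q C i) × (y ^ i * 1# ^ (q ∸ i))    ≈⟨ ×-congʳ (q C i) (trans (*-congˡ (1^ (q ∸ i))) (*-identityʳ _)) ⟩
      (q C i) × (y ^ i)                   ≈⟨ ×-congʳ (q C i) (*-identityˡ _) ⟨
      (q C i) × (1# * y ^ i)              ≈⟨ ×-assoc-* (q C i) 1# (y ^ i) ⟨
      (q C i) × 1# * y ^ i                ∎
      where open import Algebra.Properties.Semiring.Mult semiring using (×-assoc-*)
    lower : ∀ j → Binomial.binomialTerm y 1# q (Fin.inject₁ j) ≈ binomialCoeff j * y ^ Fin.toℕ j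
    lower j rewrite Fin.toℕ-inject₁ j = term (Fin.toℕ j)
    top≈ : ∀ i → i ≡ q → (q C i) × (y ^ i * 1# ^ (q ∸ i)) ≈ y ^ q
    top≈ i ≡.refl = begin
      (q C q) × (y ^ q * 1# ^ (q ∸ q))    ≈⟨ ×-cong (nCn≡1 q) (*-congˡ (^-congʳ 1# (ℕ.n∸n≡0 q))) ⟩
      1 × (y ^ q * 1#)                    ≈⟨ trans (+-identityʳ _) (*-identityʳ _) ⟩
      y ^ q                               ∎

  binomial≈0 : ∀ {j} → 0 ℕ.< j → j ℕ.< q → (q C j) × 1# ≈ 0#
  binomial≈0 {j} 0<j j<q = begin
    (q C j) × 1#                                  ≡⟨ ≡.cong (λ t → (q C t) × 1#) (Fin.toℕ-fromℕ< j<q) ⟨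
    (q C Fin.toℕ i) × 1#                          ≡⟨ coeff-tabulate binomialCoeff i ⟨
    coeff R binomialPoly (Fin.toℕ i)              ≈⟨ x-0≈x ⟨
    coeff R binomialPoly (Fin.toℕ i) - 0#         ≈⟨ +-congˡ (-‿cong (no-higher-coeff (Fin.toℕ i) (≡.subst (0 ℕ.<_) (≡.sym (Fin.toℕ-fromℕ< j<q)) 0<j))) ⟨
    coeff R binomialPoly (Fin.toℕ i) - coeff R (oneP R) (Fin.toℕ i)  ≈⟨ coeff--ₚ binomialPoly (oneP R) (Fin.toℕ i) ⟨
    coeff R (binomialPoly -ₚ oneP R) (Fin.toℕ i)  ≈⟨ binomialPoly-1≈0 (Fin.toℕ i) ⟩
    0#                                            ∎
    where
    i = Fin.fromℕ< j<q
    x-0≈x : ∀ {x} → x - 0# ≈ x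
    x-0≈x = trans (+-congˡ -0#≈0#) (+-identityʳ _)
    no-higher-coeff : ∀ t → 0 ℕ.< t → coeff R (oneP R) t ≈ 0#
    no-higher-coeff (suc zero) _ = refl
    no-higher-coeff (suc (suc t)) _ = refl
    eval≈0 : ∀ y → eval (binomialPoly -ₚ oneP R) y ≈ 0#
    eval≈0 y = begin
      eval (binomialPoly -ₚ oneP R) y                     ≈⟨ eval--ₚ binomialPoly (oneP R) y ⟩
      eval binomialPoly y - (1# + y * 0#)                 ≈⟨ +-congˡ (-‿cong (trans (+-congˡ (zeroʳ y)) (+-identityʳ _))) ⟩
      eval binomialPoly y - 1#                            ≈⟨ +-congʳ (x+y-y≈x (eval binomialPoly y) (y ^ q)) ⟨
      (eval binomialPoly y + y ^ q) - y ^ q - 1#          ≈⟨ +-congʳ (+-cong (sym (eval-binomialPoly y)) (-‿cong (x^N≈x y))) ⟩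
      (y + 1#) ^ q - y - 1#                               ≈⟨ +-congʳ (+-congʳ (x^N≈x (y + 1#))) ⟩
      (y + 1#) - y - 1#                                   ≈⟨ +-congʳ (trans (+-congʳ (+-comm y 1#)) (x+y-y≈x 1# y)) ⟩
      1# - 1#                                             ≈⟨ -‿inverseʳ 1# ⟩
      0#                                                  ∎
      where
      x+y-y≈x : ∀ x y → x + y - y ≈ x
      x+y-y≈x x y = trans (+-assoc x y (- y)) (trans (+-congˡ (-‿inverseʳ y)) (+-identityʳ x))
    p+ₚ[]≡p : ∀ p → p +ₚ [] ≡ p
    p+ₚ[]≡p [] = ≡.refl
    p+ₚ[]≡p (a ∷ p) = ≡.refl
    binomialPoly-1≈0 : IsZero (binomialPoly -ₚ oneP R)
    binomialPoly-1≈0 = roots⇒IsZero q (binomialPoly -ₚ oneP R)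
      (ℕ.≤-reflexive (≡.cong suc (≡.trans (≡.cong length (p+ₚ[]≡p (tabulate (binomialCoeff ∘ Fin.suc)))) (List.length-tabulate (binomialCoeff ∘ Fin.suc)))))
      E (λ i j i≢j Ei≈Ej → i≢j (proj₁ hasCard i j Ei≈Ej)) (eval≈0 ∘ E)

module FiniteExtension (K F : CommutativeRing 0ℓ 0ℓ) (isFK : IsField K) (isFF : IsField F)
  (ι : CommutativeRing.Carrier K → CommutativeRing.Carrier F) (hom : IsRingHom K F ι)
  {k} {e : Fin (suc k) → CommutativeRing.Carrier K} (hasCardK : HasCard K (suc k) e)
  {n} {b : Fin n → CommutativeRing.Carrier F} (basis : IsBasis K F ι b) where

  q : ℕ
  q = suc k

  private
    module K = CommutativeRing K
    module K′ = FiniteField K isFK hasCardK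
    module K-Exp = Algebra.Properties.Semiring.Exp K.semiring
    module K-Mult = Algebra.Properties.Semiring.Mult K.semiring
  open CommutativeRing F hiding (zero)
  open Extension K F ι hom
  open FieldPolynomials F isFF using (1≉0; x^t≈x-roots-not-distinct)
  open RingMorphisms.IsRingHomomorphism hom using (*-homo) renaming (+-homo to ι-+)
  open import Relation.Binary.Reasoning.Setoid setoid
  open import Algebra.Properties.Semiring.Exp semiring using (_^_; ^-congˡ; ^-congʳ; ^-assocʳ)
  open import Algebra.Properties.CommutativeSemiring.Exp commutativeSemiring using (^-distrib-*)
  open import Algebra.Properties.Semiring.Mult semiring using (_×_; ×-congʳ; ×-cong; ×-assoc-*)
  open import Algebra.Properties.Semiring.Sum semiring using (sum; sum-init-last; sum-cong-≋; sum-replicate-zero)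
  import Algebra.Properties.CommutativeSemiring.Binomial commutativeSemiring as Binomial
  open import Function.Endo.Propositional Carrier using () renaming (_^_ to _∘^_; ^-homo to ∘^-homo)

  ι-× : ∀ m a → ι (m K-Mult.× a) ≈ m × ι a
  ι-× zero a = 0#-homo
  ι-× (suc m) a = trans (ι-+ _ _) (+-congˡ (ι-× m a))

  ι-^ : ∀ a m → ι (a K-Exp.^ m) ≈ ι a ^ m
  ι-^ a zero = 1#-homo
  ι-^ a (suc m) = trans (*-homo _ _) (*-congˡ (ι-^ a m))

  ι-injective : ∀ a a′ → ι a ≈ ι a′ → a K.≈ a′
  ι-injective a a′ ιa≈ιa′ with (a K.- a′) K′.≟ K.0#
  ... | yes a-a′≈0 = KRing.x∙y⁻¹≈ε⇒x≈y _ _ a-a′≈0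
    where module KRing = Algebra.Properties.Ring K.ring
  ... | no a-a′≉0 = ⊥-elim (1≉0 (begin
    1#                                  ≈⟨ 1#-homo ⟨
    ι K.1#                              ≈⟨ ⟦⟧-cong (KF.*-inverseʳ a-a′≉0) ⟨
    ι ((a K.- a′) K.* a-a′≉0 KF.⁻¹)     ≈⟨ *-homo _ _ ⟩
    ι (a K.- a′) * ι (a-a′≉0 KF.⁻¹)     ≈⟨ *-congʳ (trans (ι-- a a′) (x≈y⇒x∙y⁻¹≈ε ιa≈ιa′)) ⟩
    0# * ι (a-a′≉0 KF.⁻¹)               ≈⟨ zeroˡ _ ⟩
    0#                                  ∎))
    where
    module KF = FieldPolynomials K isFK
    open import Algebra.Properties.Ring ring using (x≈y⇒x∙y⁻¹≈ε)

  ^q-additive : ∀ x y → (x + y) ^ q ≈ x ^ q + y ^ q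
  ^q-additive x y = begin
    (x + y) ^ q                                                  ≈⟨ Binomial.theorem q x y ⟩
    term Fin.zero + sum (λ i → term (Fin.suc i))                 ≈⟨ +-congˡ (sum-init-last (term ∘ Fin.suc)) ⟩
    term Fin.zero + (sum (λ i → term (Fin.suc (Fin.inject₁ i))) + term (Fin.fromℕ q))
        ≈⟨ +-cong (trans (+-identityʳ _) (*-identityˡ _))
                  (+-cong (trans (sum-cong-≋ {k} middle≈0) (sum-replicate-zero k)) (top≈ (Fin.toℕ (Fin.fromℕ q)) (Fin.toℕ-fromℕ q))) ⟩
    y ^ q + (0# + x ^ q)                                         ≈⟨ trans (+-congˡ (+-identityˡ _)) (+-comm _ _) ⟩
    x ^ q + y ^ q                                                ∎
    where
    term = Binomial.binomialTerm x y q
    middle≈0 : ∀ i → term (Fin.suc (Fin.inject₁ i)) ≈ 0#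
    middle≈0 i = begin
      (q C j) × z                    ≈⟨ ×-congʳ (q C j) (*-identityˡ z) ⟨
      (q C j) × (1# * z)             ≈⟨ ×-assoc-* (q C j) 1# z ⟨
      (q C j) × 1# * z               ≈⟨ *-congʳ (trans (×-congʳ (q C j) (sym 1#-homo)) (sym (ι-× (q C j) K.1#))) ⟩
      ι ((q C j) K-Mult.× K.1#) * z  ≈⟨ *-congʳ (trans (⟦⟧-cong (Kbinomial≈0 (ℕ.s≤s ℕ.z≤n) j<q)) 0#-homo) ⟩
      0# * z                         ≈⟨ zeroˡ z ⟩
      0#                             ∎
      where
      open BinomialCoefficients K isFK hasCardK renaming (binomial≈0 to Kbinomial≈0)
      j = suc (Fin.toℕ (Fin.inject₁ i))
      z = x ^ j * y ^ (q ∸ j)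
      j<q : j ℕ.< q
      j<q = ℕ.s≤s (≡.subst (ℕ._< k) (≡.sym (Fin.toℕ-inject₁ i)) (Fin.toℕ<n i))
    top≈ : ∀ j → j ≡ q → (q C j) × (x ^ j * y ^ (q ∸ j)) ≈ x ^ q
    top≈ j ≡.refl = trans (×-cong (nCn≡1 q) (*-congˡ (^-congʳ y (ℕ.n∸n≡0 q)))) (trans (+-identityʳ _) (*-identityʳ _))

  frob : Carrier → Carrier
  frob x = x ^ q

  frob-isKEndomorphism : IsKEndomorphism frob
  frob-isKEndomorphism = record
    { cong           = ^-congˡ q
    ; additive       = ^q-additive
    ; multiplicative = λ x y → ^-distrib-* x y q
    ; fixes-K        = λ c → trans (sym (ι-^ c q)) (⟦⟧-cong (K′.x^N≈x c))
    }

  frob∘^-power : ∀ t x → (frob ∘^ t) x ≈ x ^ (q ℕ.^ t)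
  frob∘^-power zero x = sym (*-identityʳ x)
  frob∘^-power (suc t) x = begin
    ((frob ∘^ t) x) ^ q       ≈⟨ ^-congˡ q (frob∘^-power t x) ⟩
    (x ^ (q ℕ.^ t)) ^ q       ≈⟨ ^-assocʳ x (q ℕ.^ t) q ⟩
    x ^ (q ℕ.^ t ℕ.* q)       ≡⟨ ≡.cong (x ^_) (ℕ.*-comm (q ℕ.^ t) q) ⟩
    x ^ (q ℕ.^ suc t)         ∎

  enumF : Fin (q ℕ.^ n) → Carrier
  enumF i = linComb K F ι (e ∘ Fin.finToFun i) b

  hasCardF : HasCard F (q ℕ.^ n) enumF
  hasCardF = enumeration-transport setoid (enumeration-→ K.setoid n hasCardK) (λ c → linComb K F ι c b)
    (linComb-congˡ b) (LinIndep⇒linComb-injective (proj₁ basis)) (proj₂ basis)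

  private module F′ = FiniteField F isFF hasCardF

  frob∘^n≈id : ∀ x → (frob ∘^ n) x ≈ x
  frob∘^n≈id x = trans (frob∘^-power n x) (F′.x^N≈x x)

  frob-fixed⇒∈K : ∀ x → frob x ≈ x → ∃ λ c → x ≈ ι c
  frob-fixed⇒∈K x x^q≈x with Fin.any? (λ i → x F′.≟ ι (e i))
  ... | yes (i , x≈ιei) = e i , x≈ιei
  ... | no x∉K = ⊥-elim (x^t≈x-roots-not-distinct K′.2≤N pts fixed distinct)
    where
    pts : Fin (suc q) → Carrier
    pts Fin.zero = x
    pts (Fin.suc i) = ι (e i)
    fixed : ∀ i → pts i ^ q ≈ pts i
    fixed Fin.zero = x^q≈x
    fixed (Fin.suc i) = IsKEndomorphism.fixes-K frob-isKEndomorphism (e i)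
    distinct : ∀ i j → ¬ i ≡ j → ¬ pts i ≈ pts j
    distinct Fin.zero Fin.zero i≢j _ = i≢j ≡.refl
    distinct Fin.zero (Fin.suc j) _ x≈ιej = x∉K (j , x≈ιej)
    distinct (Fin.suc i) Fin.zero _ ιei≈x = x∉K (i , sym ιei≈x)
    distinct (Fin.suc i) (Fin.suc j) i≢j ιei≈ιej = i≢j (≡.cong Fin.suc (proj₁ hasCardK i j (ι-injective _ _ ιei≈ιej)))

  ∘^-fixed : ∀ {g : Carrier → Carrier} → (∀ {x y} → x ≈ y → g x ≈ g y) →
             ∀ {t x} → (g ∘^ t) x ≈ x → ∀ a → (g ∘^ (a ℕ.* t)) x ≈ x
  ∘^-fixed g-cong fixed zero = refl
  ∘^-fixed {g} g-cong {t} {x} fixed (suc a) = begin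
    (g ∘^ (t ℕ.+ a ℕ.* t)) x        ≡⟨ ≡.cong-app (∘^-homo g t (a ℕ.* t)) x ⟩
    (g ∘^ t) ((g ∘^ (a ℕ.* t)) x)   ≈⟨ ∘^-cong t (∘^-fixed g-cong fixed a) ⟩
    (g ∘^ t) x                      ≈⟨ fixed ⟩
    x                               ∎
    where
    ∘^-cong : ∀ j {x y} → x ≈ y → (g ∘^ j) x ≈ (g ∘^ j) y
    ∘^-cong zero x≈y = x≈y
    ∘^-cong (suc j) x≈y = g-cong (∘^-cong j x≈y)

  -- Bézout: 1 + a n = c s (or 1 + c s = a n), so frob = frob^(1 + a n) = frob^(c s) on σ-fixed points.
  frob∘^s-fixed⇒∈K : ∀ {s} → gcd n s ≡ 1 → ∀ x → (frob ∘^ s) x ≈ x → ∃ λ c → x ≈ ι c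
  frob∘^s-fixed⇒∈K {s} gcd≡1 x σx≈x = frob-fixed⇒∈K x (frob-fixed (≡.subst (λ d → Bézout.Identity d n s) gcd≡1 (Bézout.identity (gcd-GCD n s))))
    where
    cong = IsKEndomorphism.cong frob-isKEndomorphism
    fixed-by-n = ∘^-fixed cong (frob∘^n≈id x)
    fixed-by-s = ∘^-fixed cong σx≈x
    shift : ∀ t u → suc t ≡ u → (frob ∘^ t) x ≈ x → (frob ∘^ u) x ≈ x → frob x ≈ x
    shift t u ≡.refl t-fixed u-fixed = trans (cong (sym t-fixed)) u-fixed
    frob-fixed : Bézout.Identity 1 n s → frob x ≈ x
    frob-fixed (Bézout.+- a c eq) = shift (c ℕ.* s) (a ℕ.* n) eq (fixed-by-s c) (fixed-by-n a)
    frob-fixed (Bézout.-+ a c eq) = shift (a ℕ.* n) (c ℕ.* s) eq (fixed-by-n a) (fixed-by-s c)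

module TwistedIndependence (K F : CommutativeRing 0ℓ 0ℓ) (isFK : IsField K) (isFF : IsField F)
  (ι : CommutativeRing.Carrier K → CommutativeRing.Carrier F) (hom : IsRingHom K F ι)
  {σ : CommutativeRing.Carrier F → CommutativeRing.Carrier F} (σ-endo : Extension.IsKEndomorphism K F ι hom σ)
  (σ-fixed⇒∈K : ∀ x → CommutativeRing._≈_ F (σ x) x → ∃ λ c → CommutativeRing._≈_ F x (ι c)) where

  private module K = CommutativeRing K
  open CommutativeRing F hiding (zero)
  open Extension K F ι hom
  open Sums F
  open FieldPolynomials F isFF using (1≉0; _⁻¹; *-inverseʳ; x*[y*x⁻¹]≈y; x*y≈0⇒y≈0)
  open import Relation.Binary.Reasoning.Setoid setoid
  open import Algebra.Properties.Ring ring using (x∙y⁻¹≈ε⇒x≈y; x≈y⇒x∙y⁻¹≈ε; -‿distribˡ-*)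
  open import Algebra.Solver.Ring.NaturalCoefficients.Default commutativeSemiring using (solve; _:=_; _:+_; _:*_)
  open import Function.Endo.Propositional Carrier using () renaming (_^_ to _∘^_)
  private module σ = IsKEndomorphism σ-endo

  σ^ : ℕ → Carrier → Carrier
  σ^ j = σ ∘^ j

  module σ^ j = IsKEndomorphism (IsKEndomorphism-∘^ σ-endo j)

  σ^-σ : ∀ j z → σ^ j (σ z) ≡ σ (σ^ j z)
  σ^-σ zero z = ≡.refl
  σ^-σ (suc j) z = ≡.cong σ (σ^-σ j z)

  σ^-≉0 : ∀ j {x} → ¬ x ≈ 0# → ¬ σ^ j x ≈ 0#
  σ^-≉0 j {x} x≉0 σ^x≈0 = 1≉0 (begin
    1#                            ≈⟨ σ^.g1≈1 j ⟨
    σ^ j 1#                       ≈⟨ σ^.cong j (*-inverseʳ x≉0) ⟨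
    σ^ j (x * x≉0 ⁻¹)             ≈⟨ σ^.multiplicative j x _ ⟩
    σ^ j x * σ^ j (x≉0 ⁻¹)        ≈⟨ *-congʳ σ^x≈0 ⟩
    0# * σ^ j (x≉0 ⁻¹)            ≈⟨ zeroˡ _ ⟩
    0#                            ∎)

  σ-linearized : ∀ {k} → (Fin k → Carrier) → Carrier → Carrier
  σ-linearized d z = ∑ (λ j → d j * σ^ (Fin.toℕ j) z)

  σ-linearized-isKLinear : ∀ {k} (d : Fin k → Carrier) → IsKLinear (σ-linearized d)
  σ-linearized-isKLinear d = IsKLinear-∑ _ (λ j → σ^.scaled-IsKLinear (Fin.toℕ j) (d j))

  module σ-linearized {k} (d : Fin k → Carrier) = IsKLinear (σ-linearized-isKLinear d)

  σ-linearized-* : ∀ {k} (d : Fin k → Carrier) a z → σ-linearized d (a * z) ≈ σ-linearized (λ j → d j * σ^ (Fin.toℕ j) a) z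
  σ-linearized-* d a z = ∑-cong (λ j → trans (*-congˡ (σ^.multiplicative (Fin.toℕ j) a z)) (sym (*-assoc (d j) (σ^ (Fin.toℕ j) a) (σ^ (Fin.toℕ j) z))))

  σ-linearized-- : ∀ {k} (d d′ : Fin k → Carrier) z → σ-linearized (λ j → d j - d′ j) z ≈ σ-linearized d z - σ-linearized d′ z
  σ-linearized-- d d′ z = trans (∑-cong (λ j → [y-z]x≈yx-zx (σ^ (Fin.toℕ j) z) (d j) (d′ j)))
    (∑-- (λ j → d j * σ^ (Fin.toℕ j) z) (λ j → d′ j * σ^ (Fin.toℕ j) z))
    where open import Algebra.Properties.Ring ring using ([y-z]x≈yx-zx)

  tailSums : ∀ {k} → (Fin (suc k) → Carrier) → Fin k → Carrier
  tailSums D Fin.zero = ∑ (D ∘ Fin.suc)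
  tailSums D (Fin.suc t) = tailSums (D ∘ Fin.suc) t

  -- Abel summation, with tailSums D t = Σ_{i>t} Dᵢ.
  σ-linearized-telescope : ∀ {k} (D : Fin (suc k) → Carrier) z →
                           σ-linearized D z ≈ ∑ D * z + σ-linearized (tailSums D) (σ z - z)
  σ-linearized-telescope {zero} D z = +-congʳ (*-congʳ (sym (+-identityʳ _)))
  σ-linearized-telescope {suc k} D z = begin
    D₀ * z + ∑ (λ j → D (Fin.suc j) * σ (σ^ (Fin.toℕ j) z))   ≈⟨ +-congˡ (∑-cong (λ j → *-congˡ {D (Fin.suc j)} (reflexive (≡.sym (σ^-σ (Fin.toℕ j) z))))) ⟩
    D₀ * z + σ-linearized (D ∘ Fin.suc) (σ z)                   ≈⟨ +-congˡ (σ-linearized-telescope (D ∘ Fin.suc) (σ z)) ⟩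
    D₀ * z + (P * σ z + σ-linearized T (σ (σ z) - σ z))         ≈⟨ +-congˡ (+-congˡ (σ-linearized.cong T (sym (σ.g-- (σ z) z)))) ⟩
    D₀ * z + (P * σ z + R)                                      ≈⟨ trans (+-congˡ (trans (*-congˡ (-‿inverseʳ z)) (zeroʳ P))) (+-identityʳ _) ⟨
    D₀ * z + (P * σ z + R) + P * (z - z)
      ≈⟨ solve 6 (λ D₀ P z sz mz R → D₀ :* z :+ (P :* sz :+ R) :+ P :* (z :+ mz) := (D₀ :+ P) :* z :+ (P :* (sz :+ mz) :+ R))
               refl D₀ P z (σ z) (- z) R ⟩
    (D₀ + P) * z + (P * (σ z - z) + R)                          ≈⟨ +-congˡ (+-congˡ (∑-cong (λ j → *-congˡ {T j} (reflexive (σ^-σ (Fin.toℕ j) (σ z - z)))))) ⟩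
    (D₀ + P) * z + σ-linearized (tailSums D) (σ z - z)          ∎
    where
    D₀ = D Fin.zero
    P = ∑ (D ∘ Fin.suc)
    T = tailSums (D ∘ Fin.suc)
    R = σ-linearized T (σ (σ z - z))

  tailSums≈0⇒≈0 : ∀ {k} (D : Fin (suc k) → Carrier) → ∑ D ≈ 0# → (∀ t → tailSums D t ≈ 0#) → ∀ j → D j ≈ 0#
  tailSums≈0⇒≈0 {zero} D ∑D≈0 _ Fin.zero = trans (sym (+-identityʳ _)) ∑D≈0
  tailSums≈0⇒≈0 {suc k} D ∑D≈0 T≈0 Fin.zero = trans (sym (+-identityʳ _)) (trans (+-congˡ (sym (T≈0 Fin.zero))) ∑D≈0)
  tailSums≈0⇒≈0 {suc k} D ∑D≈0 T≈0 (Fin.suc j) = tailSums≈0⇒≈0 (D ∘ Fin.suc) (T≈0 Fin.zero) (T≈0 ∘ Fin.suc) j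

  LinIndep⇒≉0 : ∀ {k} (w : Fin k → Carrier) → LinIndep K F ι w → ∀ j → ¬ w j ≈ 0#
  LinIndep⇒≉0 w indep j wj≈0 = proj₁ isFK (K.trans (K.sym (δjj≈1 j)) (indep (δ j) (trans (linComb-δ w j) wj≈0) j))
    where
    δjj≈1 : ∀ j → δ j j K.≈ K.1#
    δjj≈1 j with j Fin.≟ j
    ... | yes _ = K.refl
    ... | no j≢j = ⊥-elim (j≢j ≡.refl)

  -- If w₀, …, w_k are independent, so are the σ(zᵢ) - zᵢ for zᵢ = wᵢ₊₁ / w₀,
  -- because σ(Z) = Z forces Z ∈ K.
  σ-differences-LinIndep : ∀ {k} (w : Fin (suc k) → Carrier) (indep : LinIndep K F ι w) →
    let z = λ i → w (Fin.suc i) * LinIndep⇒≉0 w indep Fin.zero ⁻¹ in LinIndep K F ι (λ i → σ (z i) - z i)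
  σ-differences-LinIndep {k} w indep c ∑c[σz-z]≈0 t = indep c′ ∑c′w≈0 (Fin.suc t)
    where
    w₀ = w Fin.zero
    w₀≉0 = LinIndep⇒≉0 w indep Fin.zero
    z = λ i → w (Fin.suc i) * w₀≉0 ⁻¹
    Z = linComb K F ι c z
    σZ≈Z : σ Z ≈ Z
    σZ≈Z = x∙y⁻¹≈ε⇒x≈y _ _ (begin
      σ Z - Z                               ≈⟨ +-congʳ (σ.linComb-homo c z) ⟩
      linComb K F ι c (σ ∘ z) - Z           ≈⟨ ∑-- (λ i → ι (c i) * σ (z i)) (λ i → ι (c i) * z i) ⟨
      ∑ (λ i → ι (c i) * σ (z i) - ι (c i) * z i) ≈⟨ ∑-cong (λ i → x[y-z]≈xy-xz (ι (c i)) (σ (z i)) (z i)) ⟨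
      linComb K F ι c (λ i → σ (z i) - z i) ≈⟨ ∑c[σz-z]≈0 ⟩
      0#                                    ∎)
      where open import Algebra.Properties.Ring ring using (x[y-z]≈xy-xz)
    c₀ = proj₁ (σ-fixed⇒∈K Z σZ≈Z)
    Z≈ιc₀ = proj₂ (σ-fixed⇒∈K Z σZ≈Z)
    c′ : Fin (suc k) → K.Carrier
    c′ Fin.zero = K.- c₀
    c′ (Fin.suc t) = c t
    ∑c′w≈0 : linComb K F ι c′ w ≈ 0#
    ∑c′w≈0 = begin
      ι (K.- c₀) * w₀ + linComb K F ι c (w ∘ Fin.suc)    ≈⟨ +-cong (*-congʳ (-‿homo c₀)) (linComb-congʳ c (λ i → sym (x*[y*x⁻¹]≈y w₀≉0 (w (Fin.suc i))))) ⟩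
      - ι c₀ * w₀ + linComb K F ι c (λ i → w₀ * z i)
        ≈⟨ +-cong (sym (-‿distribˡ-* _ _))
                  (trans (∑-cong (λ i → x∙yz≈y∙xz (ι (c i)) w₀ (z i))) (sym (*-distribˡ-∑ w₀ (λ i → ι (c i) * z i)))) ⟩
      - (ι c₀ * w₀) + w₀ * Z                              ≈⟨ +-congˡ (trans (*-congˡ Z≈ιc₀) (*-comm _ _)) ⟩
      - (ι c₀ * w₀) + ι c₀ * w₀                           ≈⟨ -‿inverseˡ _ ⟩
      0#                                                  ∎
      where open import Algebra.Properties.CommutativeSemigroup *-commutativeSemigroup using (x∙yz≈y∙xz)

  -- Induction on k: rescaling by w₀ and Abel summation reduce the k + 1 vectors wᵢ
  -- to the k independent vectors σ(zᵢ) - zᵢ and the coefficients to the tail sums.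
  σ-linearized-vanishing⇒≈0 : ∀ {k} (w : Fin k → Carrier) → LinIndep K F ι w → (d : Fin k → Carrier) →
                              (∀ i → σ-linearized d (w i) ≈ 0#) → ∀ j → d j ≈ 0#
  σ-linearized-vanishing⇒≈0 {suc k} w indep d vanish j =
    x*y≈0⇒y≈0 (σ^-≉0 (Fin.toℕ j) w₀≉0) (trans (*-comm _ _) (tailSums≈0⇒≈0 D ∑D≈0 T≈0 j))
    where
    w₀ = w Fin.zero
    w₀≉0 = LinIndep⇒≉0 w indep Fin.zero
    z : Fin k → Carrier
    z i = w (Fin.suc i) * w₀≉0 ⁻¹
    D : Fin (suc k) → Carrier
    D j = d j * σ^ (Fin.toℕ j) w₀
    telescope : ∀ x → σ-linearized d (w₀ * x) ≈ ∑ D * x + σ-linearized (tailSums D) (σ x - x)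
    telescope x = trans (σ-linearized-* d w₀ x) (σ-linearized-telescope D x)
    ∑D≈0 : ∑ D ≈ 0#
    ∑D≈0 = begin
      ∑ D                                                   ≈⟨ *-identityʳ _ ⟨
      ∑ D * 1#                                              ≈⟨ +-identityʳ _ ⟨
      ∑ D * 1# + 0#                                         ≈⟨ +-congˡ (trans (σ-linearized.cong (tailSums D) (x≈y⇒x∙y⁻¹≈ε σ.g1≈1)) (σ-linearized.f0≈0 (tailSums D))) ⟨
      ∑ D * 1# + σ-linearized (tailSums D) (σ 1# - 1#)      ≈⟨ telescope 1# ⟨
      σ-linearized d (w₀ * 1#)                              ≈⟨ σ-linearized.cong d (*-identityʳ w₀) ⟩
      σ-linearized d w₀                                     ≈⟨ vanish Fin.zero ⟩
      0#                                                    ∎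
    T-vanish : ∀ i → σ-linearized (tailSums D) (σ (z i) - z i) ≈ 0#
    T-vanish i = begin
      σ-linearized (tailSums D) (σ (z i) - z i)                  ≈⟨ +-identityˡ _ ⟨
      0# + σ-linearized (tailSums D) (σ (z i) - z i)             ≈⟨ +-congʳ (trans (*-congʳ ∑D≈0) (zeroˡ _)) ⟨
      ∑ D * z i + σ-linearized (tailSums D) (σ (z i) - z i)      ≈⟨ telescope (z i) ⟨
      σ-linearized d (w₀ * z i)                                  ≈⟨ σ-linearized.cong d (x*[y*x⁻¹]≈y w₀≉0 (w (Fin.suc i))) ⟩
      σ-linearized d (w (Fin.suc i))                             ≈⟨ vanish (Fin.suc i) ⟩
      0#                                                         ∎
    T≈0 : ∀ t → tailSums D t ≈ 0#
    T≈0 = σ-linearized-vanishing⇒≈0 (λ i → σ (z i) - z i) (σ-differences-LinIndep w indep) (tailSums D) T-vanish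

module LinearizedRepresentatives (K F : CommutativeRing 0ℓ 0ℓ) (isFK : IsField K) (isFF : IsField F)
  (ι : CommutativeRing.Carrier K → CommutativeRing.Carrier F) (hom : IsRingHom K F ι)
  {k} {e : Fin (suc k) → CommutativeRing.Carrier K} (hasCardK : HasCard K (suc k) e)
  {n} {b : Fin n → CommutativeRing.Carrier F} (basis : IsBasis K F ι b) {s} (gcd≡1 : gcd n s ≡ 1)
  {m} {u : Fin m → CommutativeRing.Carrier F} (indep : LinIndep K F ι u) where

  private module K = CommutativeRing K
  open CommutativeRing F hiding (zero)
  open Polynomials F
  open FieldPolynomials F isFF using (roots⇒∏X-minus-∣; ∏X-minus-root)
  open Extension K F ι hom
  open Sums F
  open FiniteExtension K F isFK isFF ι hom hasCardK basis
    using (q; frob; frob-isKEndomorphism; frob∘^-power; hasCardF; frob∘^s-fixed⇒∈K)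
  open import Relation.Binary.Reasoning.Setoid setoid
  open import Algebra.Properties.Ring ring using (x∙y⁻¹≈ε⇒x≈y; x≈y⇒x∙y⁻¹≈ε)
  open import Function.Endo.Propositional Carrier using () renaming (_^_ to _∘^_; ^-homo to ∘^-homo)
  open import Data.Vec.Functional.Relation.Binary.Equality.Setoid setoid using (≋-setoid)

  σ : Carrier → Carrier
  σ = frob ∘^ s

  open TwistedIndependence K F isFK isFF ι hom (IsKEndomorphism-∘^ frob-isKEndomorphism s) (frob∘^s-fixed⇒∈K gcd≡1)

  σ^-frob : ∀ j x → σ^ j x ≈ (frob ∘^ (s ℕ.* j)) x
  σ^-frob zero x = reflexive (≡.cong (λ t → (frob ∘^ t) x) (≡.sym (ℕ.*-zeroʳ s)))
  σ^-frob (suc j) x = begin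
    σ (σ^ j x)                       ≈⟨ IsKEndomorphism.cong (IsKEndomorphism-∘^ frob-isKEndomorphism s) (σ^-frob j x) ⟩
    σ ((frob ∘^ (s ℕ.* j)) x)         ≡⟨ ≡.cong-app (∘^-homo frob s (s ℕ.* j)) x ⟨
    (frob ∘^ (s ℕ.+ s ℕ.* j)) x       ≡⟨ ≡.cong (λ t → (frob ∘^ t) x) (ℕ.*-suc s j) ⟨
    (frob ∘^ (s ℕ.* suc j)) x         ∎

  eval-sPoly : ∀ (a : Fin m → Carrier) x → eval (sPoly F q s a) x ≈ σ-linearized a x
  eval-sPoly a x = trans (eval-sumP (λ j → monomial F (a j) (q ℕ.^ (s ℕ.* Fin.toℕ j))) x) (∑-cong (λ j → begin
    eval (monomial F (a j) (q ℕ.^ (s ℕ.* Fin.toℕ j))) x    ≈⟨ eval-monomial (a j) (q ℕ.^ (s ℕ.* Fin.toℕ j)) x ⟩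
    x ^ (q ℕ.^ (s ℕ.* Fin.toℕ j)) * a j                     ≈⟨ *-comm _ _ ⟩
    a j * x ^ (q ℕ.^ (s ℕ.* Fin.toℕ j))                     ≈⟨ *-congˡ (frob∘^-power (s ℕ.* Fin.toℕ j) x) ⟨
    a j * (frob ∘^ (s ℕ.* Fin.toℕ j)) x                     ≈⟨ *-congˡ (σ^-frob (Fin.toℕ j) x) ⟨
    a j * σ^ (Fin.toℕ j) x                                  ∎))
    where open import Algebra.Properties.Semiring.Exp semiring using (_^_)

  linearized-isKLinear : ∀ L → IsLinearized F q L → IsKLinear (eval L)
  linearized-isKLinear L (cs , L≈) = IsKLinear-resp (λ x → sym (eval-≋ x (mk≋ {L} {linearized F q cs} L≈))) (from 0 cs)
    where
    open import Algebra.Properties.Semiring.Exp semiring using (_^_)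
    from : ∀ i cs → IsKLinear (eval (linearizedFrom F q i cs))
    from i [] = IsKLinear-0
    from i (c ∷ cs) = IsKLinear-resp (λ x → sym (eval-+ₚ (monomial F c (q ℕ.^ i)) _ x))
      (IsKLinear-+ (IsKLinear-resp monomial≈ (IsKEndomorphism.scaled-IsKLinear (IsKEndomorphism-∘^ frob-isKEndomorphism i) c))
                   (from (suc i) cs))
      where
      monomial≈ : ∀ x → c * (frob ∘^ i) x ≈ eval (monomial F c (q ℕ.^ i)) x
      monomial≈ x = trans (*-congˡ (frob∘^-power i x)) (trans (*-comm _ _) (sym (eval-monomial c (q ℕ.^ i) x)))

  U : (Fin m → Fin q) → Carrier
  U v = linComb K F ι (e ∘ v) u

  U-distinct : AllPairs (λ v w → ¬ U v ≈ U w) (allVecs q m)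
  U-distinct = AllPairs.map (λ (j , vj≢wj) Uv≈Uw → vj≢wj (proj₁ hasCardK _ _ (LinIndep⇒linComb-injective indep _ _ Uv≈Uw j)))
                            (allVecs-distinct q m)

  u∈U : ∀ j → Any (λ v → U v ≈ u j) (allVecs q m)
  u∈U j = Any.map (λ v≗ → trans (linComb-congˡ u (λ t → K.trans (K.reflexive (≡.cong e (v≗ t))) (K.sym (K′.E-index (δ j t))))) (linComb-δ u j))
                  (allVecs-complete q m (K′.index ∘ δ j))
    where module K′ = FiniteField K isFK hasCardK

  θ∣⇒vanishes-on-u : ∀ p → _∣P_ F (θ K F ι q e u) p → ∀ j → eval p (u j) ≈ 0#
  θ∣⇒vanishes-on-u p θ∣p j = ∣P⇒root (θ K F ι q e u) p (u j) θ∣p (∏X-minus-root U (allVecs q m) (u j) (u∈U j))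

  vanishes-on-u⇒θ∣ : ∀ p → IsKLinear (eval p) → (∀ j → eval p (u j) ≈ 0#) → _∣P_ F (θ K F ι q e u) p
  vanishes-on-u⇒θ∣ p lin p[u]≈0 =
    roots⇒∏X-minus-∣ U (allVecs q m) U-distinct p (All.universal (λ v → IsKLinear.vanishes-on-span lin p[u]≈0 (e ∘ v)) _)

  restrict : (Fin m → Carrier) → Fin m → Carrier
  restrict a j = σ-linearized a (u j)

  restrict-injective : ∀ a a′ → (∀ j → restrict a j ≈ restrict a′ j) → ∀ t → a t ≈ a′ t
  restrict-injective a a′ eq t = x∙y⁻¹≈ε⇒x≈y _ _ (σ-linearized-vanishing⇒≈0 u indep (λ j → a j - a′ j)
    (λ i → trans (σ-linearized-- a a′ (u i)) (x≈y⇒x∙y⁻¹≈ε (eq i))) t)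

  restrict-surjective : ∀ f → ∃ λ a → ∀ j → restrict a j ≈ f j
  restrict-surjective = Enumeration.injective⇒surjective (≋-setoid m) (enumeration-→ setoid m hasCardF) restrict restrict-injective

  representative : (L : Poly F) → IsLinearized F q L → ∃ λ a → _∣P_ F (θ K F ι q e u) (L -ₚ sPoly F q s a)
  representative L isLin = a , vanishes-on-u⇒θ∣ (L -ₚ sPoly F q s a) (IsKLinear-resp (λ x → sym (eval--ₚ L (sPoly F q s a) x)) lin) vanish
    where
    a = proj₁ (restrict-surjective (λ j → eval L (u j)))
    lin : IsKLinear (λ x → eval L x - eval (sPoly F q s a) x)
    lin = IsKLinear-- (linearized-isKLinear L isLin) (IsKLinear-resp (sym ∘ eval-sPoly a) (σ-linearized-isKLinear a))
    vanish : ∀ j → eval (L -ₚ sPoly F q s a) (u j) ≈ 0#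
    vanish j = trans (eval--ₚ L (sPoly F q s a) (u j))
      (x≈y⇒x∙y⁻¹≈ε (sym (trans (eval-sPoly a (u j)) (proj₂ (restrict-surjective (λ j → eval L (u j))) j))))

  unique : ∀ a a′ → _∣P_ F (θ K F ι q e u) (sPoly F q s a -ₚ sPoly F q s a′) → sPoly F q s a ≋ sPoly F q s a′
  unique a a′ θ∣ = sumP-cong (λ j → monomial-cong _ (restrict-injective a a′ agree j))
    where
    agree : ∀ j → restrict a j ≈ restrict a′ j
    agree j = begin
      σ-linearized a (u j)            ≈⟨ eval-sPoly a (u j) ⟨
      eval (sPoly F q s a) (u j)      ≈⟨ x∙y⁻¹≈ε⇒x≈y _ _ (trans (sym (eval--ₚ (sPoly F q s a) (sPoly F q s a′) (u j)))
                                                              (θ∣⇒vanishes-on-u (sPoly F q s a -ₚ sPoly F q s a′) θ∣ j)) ⟩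
      eval (sPoly F q s a′) (u j)     ≈⟨ eval-sPoly a′ (u j) ⟩
      σ-linearized a′ (u j)           ∎

open import Data.Product using (Σ; _×_)

corollary2p3 :
    (K F : CommutativeRing 0ℓ 0ℓ) → IsField K → IsField F →
    (ι : CommutativeRing.Carrier K → CommutativeRing.Carrier F) → IsRingHom K F ι →
    (q : ℕ) (e : Fin q → CommutativeRing.Carrier K) → HasCard K q e →
    (n : ℕ) → Σ (Fin n → CommutativeRing.Carrier F) (IsBasis K F ι) →
    (m : ℕ) (u : Fin m → CommutativeRing.Carrier F) → LinIndep K F ι u →
    (s : ℕ) → gcd n s ≡ 1 →
    ((L : Poly F) → IsLinearized F q L →
       Σ (Fin m → CommutativeRing.Carrier F) λ a →
         _∣P_ F (θ K F ι q e u) (_-P_ F L (sPoly F q s a)))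
    ×
    ((a b : Fin m → CommutativeRing.Carrier F) →
       _∣P_ F (θ K F ι q e u) (_-P_ F (sPoly F q s a) (sPoly F q s b)) →
       _≈P_ F (sPoly F q s a) (sPoly F q s b))
corollary2p3 K F isFK isFF ι hom zero e hasCard n basis m u indep s gcd≡1 =
  ⊥-elim (Fin.¬Fin0 (proj₁ (proj₂ hasCard (CommutativeRing.0# K))))
corollary2p3 K F isFK isFF ι hom (suc k) e hasCard n (b , basis) m u indep s gcd≡1 =
  representative , λ a a′ θ∣ → coeff-≈ (unique a a′ θ∣)
  where
  open LinearizedRepresentatives K F isFK isFF ι hom hasCard basis gcd≡1 indep
  open Polynomials F using (coeff-≈)
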